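{- Let $v\ge1$ and $q\ge 0$ be integers. If a design $\mathcal D$ with $v$ pools on $n$ objects satisfies $\hat{\mathcal D}\in\mathcal S^v_{1,q}$, then $$n\le \frac{1}{K_q}\binom{v}{\lfloor v/2\rfloor},$$ where $K_0=1$; for $q$ even, $$K_q=\sum_{s=0}^{q/2}\binom{\lfloor v/2\rfloor}{s}\binom{\lceil v/2\rceil}{s};$$ and for $q$ odd, $$K_q=K_{q-1}+\frac1T\binom{\lfloor v/2\rfloor}{(q+1)/2}\binom{\lceil v/2\rceil}{(q+1)/2},\qquad T=\left\lfloor \frac{2\lfloor v/2\rfloor}{q+1}\right\rfloor .$$
   Context: A design with $v$ pools on $n$ objects is a list $\mathcal D=(A_1,\dots,A_v)$ of subsets of $\{1,\dots,n\}$. Its dual is $\hat{\mathcal D}=(B_1,\dots,B_n)$ where $B_i=\{j\in\{1,\dots,v\}: i\in A_j\}$; $n$ is the number of members of $\hat{\mathcal D}$. For $A\subseteq\{1,\dots,n\}$ let $\phi(A)=\bigcup_{i\in A}B_i$ ($\phi(\emptyset)=\emptyset$). For integers $p,q\ge0$, $\mathcal D$ is a $(p,q)$-solution if $|\phi(A)\triangle\phi(A')|>q$ for all $A,A'\subseteq\{1,\dots,n\}$ with $A\ne A'$ and $|A|\le p$ ($\triangle$ = symmetric difference). $\mathcal S^v_{p,q}$ is the set of duals of $(p,q)$-solutions with $v$ pools, i.e. the families $(B_1,\dots,B_n)$ of subsets of $\{1,\dots,v\}$ satisfying this condition. -}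

module Defs where

open import Data.Nat as ℕ using (ℕ; zero; suc; _∸_; _≤_; _<_)
open import Data.Nat.DivMod using (_/_; _%_)
open import Data.Nat.Combinatorics using (_C_)
open import Data.Integer using (+_)
open import Data.Rational as ℚ using (ℚ; 0ℚ; 1ℚ)
open import Data.Fin using (Fin)
open import Data.Fin.Subset using (Subset; _∪_; _─_; ⋃; ∣_∣)
open import Data.Fin.Subset.Properties using (_∈?_)
open import Data.Vec using (Vec; lookup; tabulate)
open import Data.List using (List; map; filter)
open import Data.List.Base using ()
open import Data.Fin.Base using ()
open import Data.List using (List)
open import Relation.Binary.PropositionalEquality using (_≢_)
import Data.List as L

-- A design with v pools on n objects: pools A_1..A_v, each a subset of the n objects.
Design : ℕ → ℕ → Set
Design v n = Vec (Subset n) v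

dual : ∀ {v n} → Design v n → Vec (Subset v) n
dual D = tabulate λ i → tabulate λ j → lookup (lookup D j) i

φ : ∀ {v n} → Vec (Subset v) n → Subset n → Subset v
φ {n = n} B A = ⋃ (L.map (lookup B) (L.filter (_∈? A) (L.allFin n)))

_△_ : ∀ {v} → Subset v → Subset v → Subset v
X △ Y = (X ─ Y) ∪ (Y ─ X)

InS : (v p q : ℕ) → ∀ {n} → Vec (Subset v) n → Set
InS v p q {n} B = ∀ (A A′ : Subset n) → A ≢ A′ → ∣ A ∣ ≤ p → q < ∣ φ B A △ φ B A′ ∣

-- K_q (rational); the extra term for odd q is taken as 0 when T = 0
⌊v/2⌋ ⌈v/2⌉ : ℕ → ℕ
⌊v/2⌋ v = v / 2
⌈v/2⌉ v = v ∸ v / 2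

Keven : ℕ → ℕ → ℕ
Keven v zero = 1
Keven v (suc m) = Keven v m ℕ.+ (⌊v/2⌋ v C suc m) ℕ.* (⌈v/2⌉ v C suc m)

oddTerm : ℕ → ℕ → ℚ
oddTerm v q with (2 ℕ.* ⌊v/2⌋ v) / suc q
... | zero  = 0ℚ
... | suc t = (+ ((⌊v/2⌋ v C (suc q / 2)) ℕ.* (⌈v/2⌉ v C (suc q / 2)))) ℚ./ suc t

K : ℕ → ℕ → ℚ
K v q with q % 2
... | zero  = (+ Keven v (q / 2)) ℚ./ 1
... | suc _ = (+ Keven v (q / 2)) ℚ./ 1 ℚ.+ oddTerm v q

-- Write B₁, …, Bₙ ⊆ [v] for the dual family; a (1, q)-solution has ∣ Bᵢ ─ Bₗ ∣ > q for
-- i ≢ l (compare A = {l} with A′ = {l, i}). Call Y an r-neighbour of B if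
-- ∣ B ─ Y ∣ = ∣ Y ─ B ∣ ≤ r, and give Y the weight α·#{i : Y an r-neighbour of Bᵢ} +
-- β·#{i : Y an (r+1)-neighbour of Bᵢ}; take q = 2r, α = 1, β = 0 for even q, and
-- q = 2r + 1, α = T - 1, β = 1 for odd q (α = 1, β = 0 if T = 0). On a maximal chain the
-- triangle inequality ∣ X ─ Z ∣ ≤ ∣ X ─ Y ∣ + ∣ Y′ ─ Z ∣ (Y ⊆ Y′) shows that an r-neighbour
-- is the only point of positive weight; otherwise every weighted point Y of Bᵢ has
-- ∣ Bᵢ △ Y ∣ = 2r + 2 and these symmetric differences are pairwise disjoint, so there are
-- at most T of them. Every chain thus has weight at most α + β, and counting chains through
-- each Y (LYM) gives Σᵢ ∣ Bᵢ ∣! ∣ ∁ Bᵢ ∣! W(∣ Bᵢ ∣, ∣ ∁ Bᵢ ∣) ≤ v! (α + β), where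
-- W(a, b) = α Σ_{s ≤ r} C(a,s) C(b,s) + β Σ_{s ≤ r+1} C(a,s) C(b,s). An identity for these
-- sums shows that a! b! W(a, b) is smallest on the middle level, so
-- n W(⌊v/2⌋, ⌈v/2⌉) ≤ C(v, ⌊v/2⌋) (α + β), which is n K_q ≤ C(v, ⌊v/2⌋).

module Submission where

open import Defs
open import Algebra.Bundles using (CommutativeMonoid)
open import Data.Bool using (Bool; true; false; not; _∧_; _∨_; _xor_; T)
import Data.Bool as Bool
open import Data.Bool.ListAction using (any)
open import Data.Bool.Properties using (¬-not; ≤-minimum; ∨-identityʳ; ∧-identityʳ; ∧-zeroʳ; ∧-distribʳ-∨; ∨-commutativeMonoid)
open import Data.Empty using (⊥-elim)
open import Data.Fin using (Fin; zero; suc; toℕ)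
import Data.Fin.Properties as Fin
open import Data.Fin.Properties using (any?)
open import Data.Fin.Subset using (Subset; ⊥; ∁; _─_; _∪_; ⁅_⁆; ⋃; ∣_∣; _∈_)
open import Data.Fin.Subset.Properties
  using (_∈?_; ∣p∣≤n; ∣∁p∣≡n∸∣p∣; ∣⊥∣≡0; ∣⁅x⁆∣≡1; x∈⁅x⁆; x∈⁅y⁆⇒x≡y; q⊆p∪q)
open import Data.Integer as ℤ using (+_; +≤+)
open import Data.Integer.Properties using (pos-*; pos-+)
import Data.List as List
open import Data.List using ([]; _∷_)
open import Data.Nat using (ℕ; zero; suc; pred; _+_; _*_; _∸_; _≤_; _<_; _!; _≡ᵇ_; z≤n; s≤s; NonZero)
open import Data.Nat.Combinatorics using (_C_; nCk+nC[k+1]≡[n+1]C[k+1]; nC1≡n; k![n∸k]!∣n!)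
open import Data.Nat.Combinatorics.Specification using (nCk≡n!/k![n-k]!)
open import Data.Nat.Divisibility using (divides)
open import Data.Nat.DivMod
  using (_/_; _%_; m%n<n; m≡m%n+[m/n]*n; /-congˡ; /-monoˡ-≤; +-distrib-/-∣ʳ; m<n⇒m/n≡0; m*n/n≡m; m*[n/m]≡n; m/n≤m)
open import Data.Nat.Properties
open import Data.Nat.Tactic.RingSolver using (solve-∀)
open import Data.Product using (∃; _×_; _,_; proj₁; proj₂; map₂)
open import Data.Rational as ℚ using (ℚ)
open import Data.Rational.Properties as ℚ using (toℚᵘ-cancel-≤; toℚᵘ-fromℚᵘ; toℚᵘ-homo-*; toℚᵘ-homo-+)
open import Data.Rational.Unnormalised as ℚᵘ using (mkℚᵘ)
import Data.Rational.Unnormalised.Properties as ℚᵘ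
open import Data.Sum using (_⊎_; inj₁; inj₂)
open import Data.Unit using (⊤; tt)
open import Data.Vec using (Vec; []; _∷_; lookup; insertAt)
open import Data.Vec.Properties using (lookup-replicate; lookup-zipWith)
open import Data.Vec.Relation.Binary.Pointwise.Inductive as Pointwise using (Pointwise; []; _∷_)
open import Function using (_∘_)
open import Relation.Binary.PropositionalEquality
open import Relation.Nullary using (yes; no; ¬?; does)
open import Relation.Nullary.Decidable using (decidable-stable)
open import Algebra.Properties.CommutativeSemigroup +-commutativeSemigroup using (interchange; x∙yz≈y∙xz)
open import Algebra.Properties.CommutativeSemigroup (CommutativeMonoid.commutativeSemigroup ∨-commutativeMonoid)
  using () renaming (interchange to ∨-interchange)
open import Algebra.Properties.Semiring.Sum +-*-semiring
  using (sum; sum-syntax; sum-cong-≗; ∑-distrib-+; ∑-comm; *-distribˡ-sum; *-distribʳ-sum)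

⟦_⟧ : Bool → ℕ
⟦ true ⟧ = 1
⟦ false ⟧ = 0

≢0-*ˡ : ∀ m n → m * n ≢ 0 → m ≢ 0
≢0-*ˡ m n mn≢0 m≡0 = mn≢0 (cong (_* n) m≡0)

≢0-*ʳ : ∀ m n → m * n ≢ 0 → n ≢ 0
≢0-*ʳ m n mn≢0 n≡0 = mn≢0 (trans (cong (m *_) n≡0) (*-zeroʳ m))

⟦⟧≢0 : ∀ b → ⟦ b ⟧ ≢ 0 → b ≡ true
⟦⟧≢0 true _ = refl
⟦⟧≢0 false ≢0 = ⊥-elim (≢0 refl)

⟦⟧≤1 : ∀ b → ⟦ b ⟧ ≤ 1
⟦⟧≤1 true = ≤-refl
⟦⟧≤1 false = z≤n

⟦≡ᵇ⟧≢0⇒≡ : ∀ m n → ⟦ m ≡ᵇ n ⟧ ≢ 0 → m ≡ n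
⟦≡ᵇ⟧≢0⇒≡ m n ≢0 with m ≡ᵇ n in eq
... | true = ≡ᵇ⇒≡ m n (subst T (sym eq) _)
... | false = ⊥-elim (≢0 refl)

∑-mono-≤ : ∀ {n} {f g : Fin n → ℕ} → (∀ i → f i ≤ g i) → ∑[ i < n ] f i ≤ ∑[ i < n ] g i
∑-mono-≤ {zero} f≤g = z≤n
∑-mono-≤ {suc n} f≤g = +-mono-≤ (f≤g zero) (∑-mono-≤ (λ i → f≤g (suc i)))

∑-const : ∀ n c → ∑[ i < n ] c ≡ n * c
∑-const zero c = refl
∑-const (suc n) c = cong (_+_ c) (∑-const n c)

∑-zero : ∀ {n} {f : Fin n → ℕ} → (∀ i → f i ≡ 0) → sum f ≡ 0
∑-zero {n} f≡0 = trans (sum-cong-≗ f≡0) (trans (∑-const n 0) (*-zeroʳ n))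

term≤∑ : ∀ {n} (f : Fin n → ℕ) i → f i ≤ sum f
term≤∑ f zero = m≤m+n (f zero) _
term≤∑ f (suc i) = ≤-trans (term≤∑ (λ j → f (suc j)) i) (m≤n+m _ (f zero))

∑≢0⇒∃≢0 : ∀ {n} (f : Fin n → ℕ) → sum f ≢ 0 → ∃ λ i → f i ≢ 0
∑≢0⇒∃≢0 {zero} f ∑f≢0 = ⊥-elim (∑f≢0 refl)
∑≢0⇒∃≢0 {suc n} f ∑f≢0 with f zero ≟ 0
... | no f₀≢0 = zero , f₀≢0
... | yes f₀≡0 with ∑≢0⇒∃≢0 (λ i → f (suc i)) (λ ∑≡0 → ∑f≢0 (cong₂ _+_ f₀≡0 ∑≡0))
...   | i , fᵢ≢0 = suc i , fᵢ≢0

∑-≤-unique : ∀ {n M} (f : Fin n → ℕ) → (∀ i → f i ≤ M) →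
             (∀ i j → f i ≢ 0 → f j ≢ 0 → i ≡ j) → sum f ≤ M
∑-≤-unique {zero} f f≤M unique = z≤n
∑-≤-unique {suc n} {M} f f≤M unique with f zero ≟ 0
... | yes f₀≡0 rewrite f₀≡0 =
  ∑-≤-unique (λ i → f (suc i)) (λ i → f≤M (suc i)) (λ i j p q → Fin.suc-injective (unique (suc i) (suc j) p q))
... | no f₀≢0 = subst (_≤ M) (sym (trans (cong (_+_ (f zero)) tail≡0) (+-identityʳ _))) (f≤M zero)
  where
  tail≡0 : ∑[ i < n ] f (suc i) ≡ 0
  tail≡0 = ∑-zero λ i → decidable-stable (f (suc i) ≟ 0) (λ fᵢ≢0 → Fin.0≢1+n (unique zero (suc i) f₀≢0 fᵢ≢0))

∑∑-≤-unique : ∀ {m n M} (g : Fin m → Fin n → ℕ) → (∀ i j → g i j ≤ M) →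
              (∀ i j i′ j′ → g i j ≢ 0 → g i′ j′ ≢ 0 → i ≡ i′ × j ≡ j′) →
              ∑[ i < m ] ∑[ j < n ] g i j ≤ M
∑∑-≤-unique g g≤M unique = ∑-≤-unique (λ i → sum (g i))
  (λ i → ∑-≤-unique (g i) (g≤M i) (λ j j′ p q → proj₂ (unique i j i j′ p q)))
  (λ i i′ p q → let (j , p′) = ∑≢0⇒∃≢0 (g i) p ; (j′ , q′) = ∑≢0⇒∃≢0 (g i′) q
                in proj₁ (unique i j i′ j′ p′ q′))

∑ₛ : ∀ {n} → (Subset n → ℕ) → ℕ
∑ₛ {zero} f = f []
∑ₛ {suc n} f = ∑ₛ (λ Y → f (false ∷ Y)) + ∑ₛ (λ Y → f (true ∷ Y))

∑ₛ-cong : ∀ {n} {f g : Subset n → ℕ} → (∀ Y → f Y ≡ g Y) → ∑ₛ f ≡ ∑ₛ g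
∑ₛ-cong {zero} f≡g = f≡g []
∑ₛ-cong {suc n} f≡g = cong₂ _+_ (∑ₛ-cong (f≡g ∘ (false ∷_))) (∑ₛ-cong (f≡g ∘ (true ∷_)))

∑ₛ-zero : ∀ {n} {f : Subset n → ℕ} → (∀ Y → f Y ≡ 0) → ∑ₛ f ≡ 0
∑ₛ-zero {zero} f≡0 = f≡0 []
∑ₛ-zero {suc n} f≡0 = cong₂ _+_ (∑ₛ-zero (f≡0 ∘ (false ∷_))) (∑ₛ-zero (f≡0 ∘ (true ∷_)))

∑ₛ-distrib-+ : ∀ {n} (f g : Subset n → ℕ) → ∑ₛ (λ Y → f Y + g Y) ≡ ∑ₛ f + ∑ₛ g
∑ₛ-distrib-+ {zero} f g = refl
∑ₛ-distrib-+ {suc n} f g = begin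
  ∑ₛ (λ Y → f (false ∷ Y) + g (false ∷ Y)) + ∑ₛ (λ Y → f (true ∷ Y) + g (true ∷ Y))
    ≡⟨ cong₂ _+_ (∑ₛ-distrib-+ (f ∘ (false ∷_)) (g ∘ (false ∷_)))
                 (∑ₛ-distrib-+ (f ∘ (true ∷_)) (g ∘ (true ∷_))) ⟩
  (∑ₛ (f ∘ (false ∷_)) + ∑ₛ (g ∘ (false ∷_))) + (∑ₛ (f ∘ (true ∷_)) + ∑ₛ (g ∘ (true ∷_)))
    ≡⟨ interchange (∑ₛ (f ∘ (false ∷_))) (∑ₛ (g ∘ (false ∷_))) (∑ₛ (f ∘ (true ∷_))) (∑ₛ (g ∘ (true ∷_))) ⟩
  ∑ₛ f + ∑ₛ g ∎
  where open ≡-Reasoning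

*-distribˡ-∑ₛ : ∀ {n} c (f : Subset n → ℕ) → c * ∑ₛ f ≡ ∑ₛ (λ Y → c * f Y)
*-distribˡ-∑ₛ {zero} c f = refl
*-distribˡ-∑ₛ {suc n} c f = trans (*-distribˡ-+ c _ _)
  (cong₂ _+_ (*-distribˡ-∑ₛ c (f ∘ (false ∷_))) (*-distribˡ-∑ₛ c (f ∘ (true ∷_))))

∑ₛ-∑-comm : ∀ {n m} (f : Subset n → Fin m → ℕ) →
            ∑ₛ (λ Y → ∑[ i < m ] f Y i) ≡ ∑[ i < m ] ∑ₛ (λ Y → f Y i)
∑ₛ-∑-comm {zero} f = refl
∑ₛ-∑-comm {suc n} f = trans
  (cong₂ _+_ (∑ₛ-∑-comm (f ∘ (false ∷_))) (∑ₛ-∑-comm (f ∘ (true ∷_))))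
  (sym (∑-distrib-+ (λ i → ∑ₛ (λ Y → f (false ∷ Y) i)) (λ i → ∑ₛ (λ Y → f (true ∷ Y) i))))

∣p∣+∣∁p∣≡n : ∀ {n} (p : Subset n) → ∣ p ∣ + ∣ ∁ p ∣ ≡ n
∣p∣+∣∁p∣≡n p = trans (cong (_+_ ∣ p ∣) (∣∁p∣≡n∸∣p∣ p)) (m+[n∸m]≡n (∣p∣≤n p))

∣q∣+∣p─q∣≡∣p∣+∣q─p∣ : ∀ {n} (p q : Subset n) → ∣ q ∣ + ∣ p ─ q ∣ ≡ ∣ p ∣ + ∣ q ─ p ∣
∣q∣+∣p─q∣≡∣p∣+∣q─p∣ [] [] = refl
∣q∣+∣p─q∣≡∣p∣+∣q─p∣ (true ∷ p) (true ∷ q) = cong suc (∣q∣+∣p─q∣≡∣p∣+∣q─p∣ p q)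
∣q∣+∣p─q∣≡∣p∣+∣q─p∣ (true ∷ p) (false ∷ q) =
  trans (+-suc ∣ q ∣ ∣ p ─ q ∣) (cong suc (∣q∣+∣p─q∣≡∣p∣+∣q─p∣ p q))
∣q∣+∣p─q∣≡∣p∣+∣q─p∣ (false ∷ p) (true ∷ q) =
  trans (cong suc (∣q∣+∣p─q∣≡∣p∣+∣q─p∣ p q)) (sym (+-suc ∣ p ∣ ∣ q ─ p ∣))
∣q∣+∣p─q∣≡∣p∣+∣q─p∣ (false ∷ p) (false ∷ q) = ∣q∣+∣p─q∣≡∣p∣+∣q─p∣ p q

∣p─q∣≡∣q─p∣⇒∣q∣≡∣p∣ : ∀ {n} (p q : Subset n) → ∣ p ─ q ∣ ≡ ∣ q ─ p ∣ → ∣ q ∣ ≡ ∣ p ∣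
∣p─q∣≡∣q─p∣⇒∣q∣≡∣p∣ p q eq =
  +-cancelʳ-≡ _ ∣ q ∣ ∣ p ∣ (trans (∣q∣+∣p─q∣≡∣p∣+∣q─p∣ p q) (cong (_+_ ∣ p ∣) (sym eq)))

∣p─q∣≡∣q─p∣⇒∣∁q∣≡∣∁p∣ : ∀ {n} (p q : Subset n) → ∣ p ─ q ∣ ≡ ∣ q ─ p ∣ → ∣ ∁ q ∣ ≡ ∣ ∁ p ∣
∣p─q∣≡∣q─p∣⇒∣∁q∣≡∣∁p∣ {n} p q eq = begin
  ∣ ∁ q ∣   ≡⟨ ∣∁p∣≡n∸∣p∣ q ⟩
  n ∸ ∣ q ∣ ≡⟨ cong (n ∸_) (∣p─q∣≡∣q─p∣⇒∣q∣≡∣p∣ p q eq) ⟩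
  n ∸ ∣ p ∣ ≡⟨ ∣∁p∣≡n∸∣p∣ p ⟨
  ∣ ∁ p ∣   ∎
  where open ≡-Reasoning

∣insertAt∣ : ∀ {n} (p : Subset n) x → ∣ insertAt p x true ∣ ≡ suc ∣ p ∣
∣insertAt∣ p zero = refl
∣insertAt∣ (true ∷ p) (suc x) = cong suc (∣insertAt∣ p x)
∣insertAt∣ (false ∷ p) (suc x) = ∣insertAt∣ p x

∣∁insertAt∣ : ∀ {n} (p : Subset n) x → ∣ ∁ (insertAt p x true) ∣ ≡ ∣ ∁ p ∣
∣∁insertAt∣ p zero = refl
∣∁insertAt∣ (true ∷ p) (suc x) = ∣∁insertAt∣ p x
∣∁insertAt∣ (false ∷ p) (suc x) = cong suc (∣∁insertAt∣ p x)

-- Maximal chains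

chainsThrough : ∀ {n} → Subset n → ℕ
chainsThrough Y = ∣ Y ∣ ! * ∣ ∁ Y ∣ !

-- A maximal chain of subsets of an (n+1)-set is encoded by the element added
-- first, followed by a maximal chain of the remaining n coordinates.
Chain : ℕ → Set
Chain zero = ⊤
Chain (suc n) = Fin (suc n) × Chain n

level : ∀ {n} → Chain n → Fin (suc n) → Subset n
level {zero} _ _ = []
level {suc n} _ zero = ⊥
level {suc n} (x , c) (suc j) = insertAt (level c j) x true

∑ᶜ : ∀ {n} → (Chain n → ℕ) → ℕ
∑ᶜ {zero} f = f tt
∑ᶜ {suc n} f = ∑[ x < suc n ] ∑ᶜ (λ c → f (x , c))

∑ᶜ-mono-≤ : ∀ {n} {f g : Chain n → ℕ} → (∀ c → f c ≤ g c) → ∑ᶜ f ≤ ∑ᶜ g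
∑ᶜ-mono-≤ {zero} f≤g = f≤g tt
∑ᶜ-mono-≤ {suc n} f≤g = ∑-mono-≤ (λ x → ∑ᶜ-mono-≤ (λ c → f≤g (x , c)))

∑ᶜ-distrib-+ : ∀ {n} (f g : Chain n → ℕ) → ∑ᶜ (λ c → f c + g c) ≡ ∑ᶜ f + ∑ᶜ g
∑ᶜ-distrib-+ {zero} f g = refl
∑ᶜ-distrib-+ {suc n} f g = trans
  (sum-cong-≗ (λ x → ∑ᶜ-distrib-+ (λ c → f (x , c)) (λ c → g (x , c))))
  (∑-distrib-+ (λ x → ∑ᶜ (λ c → f (x , c))) (λ x → ∑ᶜ (λ c → g (x , c))))

∑ᶜ-const : ∀ n k → ∑ᶜ {n} (λ _ → k) ≡ n ! * k
∑ᶜ-const zero k = sym (+-identityʳ k)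
∑ᶜ-const (suc n) k = begin
  ∑[ x < suc n ] ∑ᶜ {n} (λ _ → k) ≡⟨ sum-cong-≗ {suc n} (λ _ → ∑ᶜ-const n k) ⟩
  ∑[ x < suc n ] (n ! * k)        ≡⟨ ∑-const (suc n) (n ! * k) ⟩
  suc n * (n ! * k)               ≡⟨ *-assoc (suc n) (n !) k ⟨
  suc n ! * k                     ∎
  where open ≡-Reasoning

∣level∣ : ∀ {n} (c : Chain n) j → ∣ level c j ∣ ≡ toℕ j
∣level∣ {zero} _ zero = refl
∣level∣ {suc n} _ zero = ∣⊥∣≡0 (suc n)
∣level∣ {suc n} (x , c) (suc j) = trans (∣insertAt∣ (level c j) x) (cong suc (∣level∣ c j))

⊥-least : ∀ {n} (p : Subset n) → Pointwise Bool._≤_ (⊥ {n}) p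
⊥-least [] = []
⊥-least (b ∷ p) = ≤-minimum b ∷ ⊥-least p

insertAt⁺ : ∀ {n} {p q : Subset n} x → Pointwise Bool._≤_ p q →
            Pointwise Bool._≤_ (insertAt p x true) (insertAt q x true)
insertAt⁺ zero p≤q = Bool.b≤b ∷ p≤q
insertAt⁺ (suc x) (b≤b′ ∷ p≤q) = b≤b′ ∷ insertAt⁺ x p≤q

level-mono : ∀ {n} (c : Chain n) {j j′} → toℕ j ≤ toℕ j′ →
             Pointwise Bool._≤_ (level c j) (level c j′)
level-mono {zero} _ {zero} {zero} _ = []
level-mono {suc n} c {zero} {j′} _ = ⊥-least (level c j′)
level-mono {suc n} (x , c) {suc j} {suc j′} (s≤s j≤j′) = insertAt⁺ x (level-mono c j≤j′)

∑-∑ₛ-insertAt : ∀ {n} (f : Subset (suc n) → ℕ) →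
                ∑[ x < suc n ] ∑ₛ (λ Y → f (insertAt Y x true)) ≡ ∑ₛ (λ Z → ∣ Z ∣ * f Z)
∑-∑ₛ-insertAt {zero} f = refl
∑-∑ₛ-insertAt {suc n} f = begin
  A + ∑[ x < suc n ] (∑ₛ (λ Y → f (false ∷ insertAt Y x true)) + ∑ₛ (λ Y → f (true ∷ insertAt Y x true)))
    ≡⟨ cong (_+_ A) (∑-distrib-+ (λ x → ∑ₛ (λ Y → f (false ∷ insertAt Y x true)))
                                 (λ x → ∑ₛ (λ Y → f (true ∷ insertAt Y x true)))) ⟩
  A + (∑[ x < suc n ] ∑ₛ (λ Y → f (false ∷ insertAt Y x true))
       + ∑[ x < suc n ] ∑ₛ (λ Y → f (true ∷ insertAt Y x true)))
    ≡⟨ cong₂ (λ a b → A + (a + b)) (∑-∑ₛ-insertAt (f ∘ (false ∷_))) (∑-∑ₛ-insertAt (f ∘ (true ∷_))) ⟩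
  A + (B₀ + B₁)
    ≡⟨ x∙yz≈y∙xz A B₀ B₁ ⟩
  B₀ + (A + B₁)
    ≡⟨ cong (_+_ B₀) (∑ₛ-distrib-+ (f ∘ (true ∷_)) (λ Z → ∣ Z ∣ * f (true ∷ Z))) ⟨
  B₀ + ∑ₛ (λ Z → suc ∣ Z ∣ * f (true ∷ Z)) ∎
  where
  open ≡-Reasoning
  A = ∑ₛ (λ Y → f (true ∷ Y))
  B₀ = ∑ₛ (λ Z → ∣ Z ∣ * f (false ∷ Z))
  B₁ = ∑ₛ (λ Z → ∣ Z ∣ * f (true ∷ Z))

∑ₛ-[∣Y∣≡0]* : ∀ {n} (h : Subset n → ℕ) → ∑ₛ (λ Y → ⟦ ∣ Y ∣ ≡ᵇ 0 ⟧ * h Y) ≡ h ⊥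
∑ₛ-[∣Y∣≡0]* {zero} h = +-identityʳ (h [])
∑ₛ-[∣Y∣≡0]* {suc n} h =
  trans (cong₂ _+_ (∑ₛ-[∣Y∣≡0]* (h ∘ (false ∷_))) (∑ₛ-zero {n} (λ _ → refl))) (+-identityʳ _)

factorial-split : ∀ c w e → w * (c ! * e) ≡ ⟦ c ≡ᵇ 0 ⟧ * (w * e) + c * (w * (pred c ! * e))
factorial-split zero w e =
  trans (cong (_*_ w) (*-identityˡ e)) (sym (trans (+-identityʳ _) (*-identityˡ (w * e))))
factorial-split (suc c) w e = reassoc (suc c) (c !) w e
  where
  reassoc : ∀ a b w e → w * ((a * b) * e) ≡ a * (w * (b * e))
  reassoc = solve-∀

∑ᶜ-levels : ∀ {n} (w : Subset n → ℕ) →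
            ∑ᶜ (λ c → ∑[ j < suc n ] w (level c j)) ≡ ∑ₛ (λ Y → w Y * chainsThrough Y)
∑ᶜ-levels {zero} w = trans (+-identityʳ (w [])) (sym (*-identityʳ (w [])))
∑ᶜ-levels {suc n} w = begin
  ∑[ x < suc n ] ∑ᶜ (λ c → w ⊥ + ∑[ j < suc n ] w (ins x (level c j)))
    ≡⟨ sum-cong-≗ (λ x → trans (∑ᶜ-distrib-+ {n} (λ _ → w ⊥) _)
                               (cong₂ _+_ (∑ᶜ-const n (w ⊥)) (∑ᶜ-levels (w ∘ ins x)))) ⟩
  ∑[ x < suc n ] (n ! * w ⊥ + ∑ₛ (λ Y → w (ins x Y) * chainsThrough Y))
    ≡⟨ ∑-distrib-+ (λ _ → n ! * w ⊥) (λ x → ∑ₛ (λ Y → w (ins x Y) * chainsThrough Y)) ⟩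
  ∑[ x < suc n ] (n ! * w ⊥) + ∑[ x < suc n ] ∑ₛ (λ Y → w (ins x Y) * chainsThrough Y)
    ≡⟨ cong₂ _+_ bottom (sum-cong-≗ λ x → ∑ₛ-cong λ Y → sym (g∘ins x Y)) ⟩
  ∑ₛ (λ Z → ⟦ ∣ Z ∣ ≡ᵇ 0 ⟧ * (w Z * ∣ ∁ Z ∣ !)) + ∑[ x < suc n ] ∑ₛ (λ Y → g (ins x Y))
    ≡⟨ cong (_+_ (∑ₛ (λ Z → ⟦ ∣ Z ∣ ≡ᵇ 0 ⟧ * (w Z * ∣ ∁ Z ∣ !)))) (∑-∑ₛ-insertAt g) ⟩
  ∑ₛ (λ Z → ⟦ ∣ Z ∣ ≡ᵇ 0 ⟧ * (w Z * ∣ ∁ Z ∣ !)) + ∑ₛ (λ Z → ∣ Z ∣ * g Z)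
    ≡⟨ ∑ₛ-distrib-+ (λ Z → ⟦ ∣ Z ∣ ≡ᵇ 0 ⟧ * (w Z * ∣ ∁ Z ∣ !)) (λ Z → ∣ Z ∣ * g Z) ⟨
  ∑ₛ (λ Z → ⟦ ∣ Z ∣ ≡ᵇ 0 ⟧ * (w Z * ∣ ∁ Z ∣ !) + ∣ Z ∣ * g Z)
    ≡⟨ ∑ₛ-cong (λ Z → factorial-split ∣ Z ∣ (w Z) (∣ ∁ Z ∣ !)) ⟨
  ∑ₛ (λ Z → w Z * chainsThrough Z) ∎
  where
  open ≡-Reasoning
  ins : Fin (suc n) → Subset n → Subset (suc n)
  ins x Y = insertAt Y x true
  -- Z = insertAt Y x true for ∣ Z ∣ pairs (x , Y), each with chainsThrough Y = (∣ Z ∣ ∸ 1)! ∣ ∁ Z ∣!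
  g : Subset (suc n) → ℕ
  g Z = w Z * (pred ∣ Z ∣ ! * ∣ ∁ Z ∣ !)
  g∘ins : ∀ x Y → g (ins x Y) ≡ w (ins x Y) * chainsThrough Y
  g∘ins x Y rewrite ∣insertAt∣ Y x | ∣∁insertAt∣ Y x = refl
  ∣∁⊥∣≡1+n : ∣ ∁ (⊥ {suc n}) ∣ ≡ suc n
  ∣∁⊥∣≡1+n = trans (∣∁p∣≡n∸∣p∣ (⊥ {suc n})) (cong (suc n ∸_) (∣⊥∣≡0 (suc n)))
  bottom : ∑[ x < suc n ] (n ! * w ⊥) ≡ ∑ₛ (λ Z → ⟦ ∣ Z ∣ ≡ᵇ 0 ⟧ * (w Z * ∣ ∁ Z ∣ !))
  bottom = begin
    ∑[ x < suc n ] (n ! * w ⊥) ≡⟨ ∑-const (suc n) (n ! * w ⊥) ⟩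
    suc n * (n ! * w ⊥)        ≡⟨ *-assoc (suc n) (n !) (w ⊥) ⟨
    suc n ! * w ⊥              ≡⟨ *-comm (suc n !) (w ⊥) ⟩
    w ⊥ * suc n !              ≡⟨ cong (λ k → w ⊥ * k !) ∣∁⊥∣≡1+n ⟨
    w ⊥ * ∣ ∁ (⊥ {suc n}) ∣ !  ≡⟨ ∑ₛ-[∣Y∣≡0]* (λ Z → w Z * ∣ ∁ Z ∣ !) ⟨
    ∑ₛ (λ Z → ⟦ ∣ Z ∣ ≡ᵇ 0 ⟧ * (w Z * ∣ ∁ Z ∣ !)) ∎

lubell : ∀ {n} (w : Subset n → ℕ) M → (∀ c → ∑[ j < suc n ] w (level c j) ≤ M) →
         ∑ₛ (λ Y → w Y * chainsThrough Y) ≤ n ! * M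
lubell {n} w M bound = begin
  ∑ₛ (λ Y → w Y * chainsThrough Y)        ≡⟨ ∑ᶜ-levels w ⟨
  ∑ᶜ (λ c → ∑[ j < suc n ] w (level c j)) ≤⟨ ∑ᶜ-mono-≤ bound ⟩
  ∑ᶜ {n} (λ _ → M)                        ≡⟨ ∑ᶜ-const n M ⟩
  n ! * M                                 ∎
  where open ≤-Reasoning

-- Balls around a code word

sphere : ℕ → ∀ {n} → Subset n → Subset n → ℕ
sphere s B Y = ⟦ ∣ B ─ Y ∣ ≡ᵇ s ⟧ * ⟦ ∣ Y ─ B ∣ ≡ᵇ s ⟧

ball : ℕ → ∀ {n} → Subset n → Subset n → ℕ
ball zero = sphere zero
ball (suc r) B Y = ball r B Y + sphere (suc r) B Y

sphere≤1 : ∀ s {n} (B Y : Subset n) → sphere s B Y ≤ 1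
sphere≤1 s B Y = *-mono-≤ (⟦⟧≤1 (∣ B ─ Y ∣ ≡ᵇ s)) (⟦⟧≤1 (∣ Y ─ B ∣ ≡ᵇ s))

sphere≢0 : ∀ s {n} (B Y : Subset n) → sphere s B Y ≢ 0 → ∣ B ─ Y ∣ ≡ s × ∣ Y ─ B ∣ ≡ s
sphere≢0 s B Y ≢0 = ⟦≡ᵇ⟧≢0⇒≡ (∣ B ─ Y ∣) s (≢0-*ˡ _ ⟦ ∣ Y ─ B ∣ ≡ᵇ s ⟧ ≢0)
                  , ⟦≡ᵇ⟧≢0⇒≡ (∣ Y ─ B ∣) s (≢0-*ʳ ⟦ ∣ B ─ Y ∣ ≡ᵇ s ⟧ _ ≢0)

ball≢0 : ∀ r {n} (B Y : Subset n) → ball r B Y ≢ 0 → ∣ B ─ Y ∣ ≡ ∣ Y ─ B ∣ × ∣ B ─ Y ∣ ≤ r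
ball≢0 zero B Y ≢0 =
  let (d₁≡0 , d₂≡0) = sphere≢0 zero B Y ≢0 in trans d₁≡0 (sym d₂≡0) , ≤-reflexive d₁≡0
ball≢0 (suc r) B Y ≢0 with ball r B Y ≟ 0
... | no ball≢0′ = map₂ m≤n⇒m≤1+n (ball≢0 r B Y ball≢0′)
... | yes ball≡0 =
  let (d₁≡s , d₂≡s) = sphere≢0 (suc r) B Y (λ sphere≡0 → ≢0 (cong₂ _+_ ball≡0 sphere≡0))
  in trans d₁≡s (sym d₂≡s) , ≤-reflexive d₁≡s

ball≤1 : ∀ r {n} (B Y : Subset n) → ball r B Y ≤ 1
ball≤1 zero = sphere≤1 zero
ball≤1 (suc r) B Y with ball r B Y ≟ 0
... | yes ball≡0 rewrite ball≡0 = sphere≤1 (suc r) B Y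
... | no ball≢0′ = subst (λ k → ball r B Y + k ≤ 1) (sym sphere≡0)
                     (subst (_≤ 1) (sym (+-identityʳ _)) (ball≤1 r B Y))
  where
  sphere≡0 : sphere (suc r) B Y ≡ 0
  sphere≡0 = decidable-stable (sphere (suc r) B Y ≟ 0) λ ≢0 →
    1+n≰n (subst (_≤ r) (proj₁ (sphere≢0 (suc r) B Y ≢0)) (proj₂ (ball≢0 r B Y ball≢0′)))

ballSize : ℕ → ℕ → ℕ → ℕ
ballSize zero a b = 1
ballSize (suc r) a b = ballSize r a b + (a C suc r) * (b C suc r)

∑ₛ-sphere-count : ∀ {n} (B : Subset n) s t →
  ∑ₛ (λ Y → ⟦ ∣ B ─ Y ∣ ≡ᵇ s ⟧ * ⟦ ∣ Y ─ B ∣ ≡ᵇ t ⟧) ≡ (∣ B ∣ C s) * (∣ ∁ B ∣ C t)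
∑ₛ-sphere-count [] zero zero = refl
∑ₛ-sphere-count [] zero (suc t) = refl
∑ₛ-sphere-count [] (suc s) t = refl
∑ₛ-sphere-count {suc n} (true ∷ B) zero t = cong₂ _+_ (∑ₛ-zero {n} (λ _ → refl)) (∑ₛ-sphere-count B zero t)
∑ₛ-sphere-count (true ∷ B) (suc s) t = begin
  ∑ₛ (λ Y → ⟦ ∣ B ─ Y ∣ ≡ᵇ s ⟧ * ⟦ ∣ Y ─ B ∣ ≡ᵇ t ⟧) + ∑ₛ (λ Y → ⟦ ∣ B ─ Y ∣ ≡ᵇ suc s ⟧ * ⟦ ∣ Y ─ B ∣ ≡ᵇ t ⟧)
    ≡⟨ cong₂ _+_ (∑ₛ-sphere-count B s t) (∑ₛ-sphere-count B (suc s) t) ⟩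
  (∣ B ∣ C s) * (∣ ∁ B ∣ C t) + (∣ B ∣ C suc s) * (∣ ∁ B ∣ C t)
    ≡⟨ *-distribʳ-+ (∣ ∁ B ∣ C t) (∣ B ∣ C s) (∣ B ∣ C suc s) ⟨
  (∣ B ∣ C s + ∣ B ∣ C suc s) * (∣ ∁ B ∣ C t)
    ≡⟨ cong (_* (∣ ∁ B ∣ C t)) (nCk+nC[k+1]≡[n+1]C[k+1] ∣ B ∣ s) ⟩
  (suc ∣ B ∣ C suc s) * (∣ ∁ B ∣ C t) ∎
  where open ≡-Reasoning
∑ₛ-sphere-count (false ∷ B) s zero = trans
  (cong₂ _+_ (∑ₛ-sphere-count B s zero) (∑ₛ-zero (λ Y → *-zeroʳ ⟦ ∣ B ─ Y ∣ ≡ᵇ s ⟧)))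
  (+-identityʳ _)
∑ₛ-sphere-count (false ∷ B) s (suc t) = begin
  ∑ₛ (λ Y → ⟦ ∣ B ─ Y ∣ ≡ᵇ s ⟧ * ⟦ ∣ Y ─ B ∣ ≡ᵇ suc t ⟧) + ∑ₛ (λ Y → ⟦ ∣ B ─ Y ∣ ≡ᵇ s ⟧ * ⟦ ∣ Y ─ B ∣ ≡ᵇ t ⟧)
    ≡⟨ cong₂ _+_ (∑ₛ-sphere-count B s (suc t)) (∑ₛ-sphere-count B s t) ⟩
  (∣ B ∣ C s) * (∣ ∁ B ∣ C suc t) + (∣ B ∣ C s) * (∣ ∁ B ∣ C t)
    ≡⟨ *-distribˡ-+ (∣ B ∣ C s) (∣ ∁ B ∣ C suc t) (∣ ∁ B ∣ C t) ⟨
  (∣ B ∣ C s) * (∣ ∁ B ∣ C suc t + ∣ ∁ B ∣ C t)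
    ≡⟨ cong (λ k → (∣ B ∣ C s) * k) (trans (+-comm (∣ ∁ B ∣ C suc t) _) (nCk+nC[k+1]≡[n+1]C[k+1] ∣ ∁ B ∣ t)) ⟩
  (∣ B ∣ C s) * (suc ∣ ∁ B ∣ C suc t) ∎
  where open ≡-Reasoning

sphere-chainsThrough : ∀ {n} (B Y : Subset n) s →
  sphere s B Y * chainsThrough Y ≡ sphere s B Y * chainsThrough B
sphere-chainsThrough B Y s with sphere s B Y ≟ 0
... | yes ≡0 rewrite ≡0 = refl
... | no ≢0 = cong (sphere s B Y *_)
  (cong₂ (λ a b → a ! * b !) (∣p─q∣≡∣q─p∣⇒∣q∣≡∣p∣ B Y balanced) (∣p─q∣≡∣q─p∣⇒∣∁q∣≡∣∁p∣ B Y balanced))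
  where
  balanced : ∣ B ─ Y ∣ ≡ ∣ Y ─ B ∣
  balanced = let (d₁≡s , d₂≡s) = sphere≢0 s B Y ≢0 in trans d₁≡s (sym d₂≡s)

∑ₛ-sphere : ∀ {n} (B : Subset n) s →
  ∑ₛ (λ Y → sphere s B Y * chainsThrough Y) ≡ chainsThrough B * ((∣ B ∣ C s) * (∣ ∁ B ∣ C s))
∑ₛ-sphere B s = begin
  ∑ₛ (λ Y → sphere s B Y * chainsThrough Y)
    ≡⟨ ∑ₛ-cong (λ Y → trans (sphere-chainsThrough B Y s) (*-comm _ (chainsThrough B))) ⟩
  ∑ₛ (λ Y → chainsThrough B * sphere s B Y)
    ≡⟨ *-distribˡ-∑ₛ (chainsThrough B) (λ Y → sphere s B Y) ⟨
  chainsThrough B * ∑ₛ (λ Y → sphere s B Y)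
    ≡⟨ cong (chainsThrough B *_) (∑ₛ-sphere-count B s s) ⟩
  chainsThrough B * ((∣ B ∣ C s) * (∣ ∁ B ∣ C s)) ∎
  where open ≡-Reasoning

∑ₛ-ball : ∀ {n} (B : Subset n) r →
  ∑ₛ (λ Y → ball r B Y * chainsThrough Y) ≡ chainsThrough B * ballSize r (∣ B ∣) (∣ ∁ B ∣)
∑ₛ-ball B zero = ∑ₛ-sphere B zero
∑ₛ-ball B (suc r) = begin
  ∑ₛ (λ Y → (ball r B Y + sphere (suc r) B Y) * chainsThrough Y)
    ≡⟨ ∑ₛ-cong (λ Y → *-distribʳ-+ (chainsThrough Y) (ball r B Y) _) ⟩
  ∑ₛ (λ Y → ball r B Y * chainsThrough Y + sphere (suc r) B Y * chainsThrough Y)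
    ≡⟨ ∑ₛ-distrib-+ (λ Y → ball r B Y * chainsThrough Y) _ ⟩
  ∑ₛ (λ Y → ball r B Y * chainsThrough Y) + ∑ₛ (λ Y → sphere (suc r) B Y * chainsThrough Y)
    ≡⟨ cong₂ _+_ (∑ₛ-ball B r) (∑ₛ-sphere B (suc r)) ⟩
  chainsThrough B * ballSize r (∣ B ∣) (∣ ∁ B ∣) + chainsThrough B * ((∣ B ∣ C suc r) * (∣ ∁ B ∣ C suc r))
    ≡⟨ *-distribˡ-+ (chainsThrough B) _ _ ⟨
  chainsThrough B * ballSize (suc r) (∣ B ∣) (∣ ∁ B ∣) ∎
  where open ≡-Reasoning

∣p∣≡∑ : ∀ {n} (p : Subset n) → ∣ p ∣ ≡ ∑[ i < n ] ⟦ lookup p i ⟧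
∣p∣≡∑ [] = refl
∣p∣≡∑ (true ∷ p) = cong suc (∣p∣≡∑ p)
∣p∣≡∑ (false ∷ p) = ∣p∣≡∑ p

∣p─q∣≡∑ : ∀ {n} (p q : Subset n) → ∣ p ─ q ∣ ≡ ∑[ i < n ] ⟦ lookup p i ∧ not (lookup q i) ⟧
∣p─q∣≡∑ [] [] = refl
∣p─q∣≡∑ (true ∷ p) (true ∷ q) = ∣p─q∣≡∑ p q
∣p─q∣≡∑ (true ∷ p) (false ∷ q) = cong suc (∣p─q∣≡∑ p q)
∣p─q∣≡∑ (false ∷ p) (true ∷ q) = ∣p─q∣≡∑ p q
∣p─q∣≡∑ (false ∷ p) (false ∷ q) = ∣p─q∣≡∑ p q

lookup-△ : ∀ {n} (p q : Subset n) i → lookup (p △ q) i ≡ lookup p i xor lookup q i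
lookup-△ (true ∷ p) (true ∷ q) zero = refl
lookup-△ (true ∷ p) (false ∷ q) zero = refl
lookup-△ (false ∷ p) (true ∷ q) zero = refl
lookup-△ (false ∷ p) (false ∷ q) zero = refl
lookup-△ (_ ∷ p) (_ ∷ q) (suc i) = lookup-△ p q i

∣p△q∣≡∣p─q∣+∣q─p∣ : ∀ {n} (p q : Subset n) → ∣ p △ q ∣ ≡ ∣ p ─ q ∣ + ∣ q ─ p ∣
∣p△q∣≡∣p─q∣+∣q─p∣ [] [] = refl
∣p△q∣≡∣p─q∣+∣q─p∣ (true ∷ p) (true ∷ q) = ∣p△q∣≡∣p─q∣+∣q─p∣ p q
∣p△q∣≡∣p─q∣+∣q─p∣ (true ∷ p) (false ∷ q) = cong suc (∣p△q∣≡∣p─q∣+∣q─p∣ p q)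
∣p△q∣≡∣p─q∣+∣q─p∣ (false ∷ p) (true ∷ q) =
  trans (cong suc (∣p△q∣≡∣p─q∣+∣q─p∣ p q)) (sym (+-suc ∣ p ─ q ∣ ∣ q ─ p ∣))
∣p△q∣≡∣p─q∣+∣q─p∣ (false ∷ p) (false ∷ q) = ∣p△q∣≡∣p─q∣+∣q─p∣ p q

overlap-triangleᵇ : ∀ x z {y y′} → y Bool.≤ y′ →
  ⟦ x ∧ not z ⟧ + ⟦ x xor y ⟧ * ⟦ z xor y′ ⟧ ≤ ⟦ x ∧ not y ⟧ + ⟦ y′ ∧ not z ⟧
overlap-triangleᵇ true true Bool.f≤t = ≤ᵇ⇒≤ _ _ _
overlap-triangleᵇ true false Bool.f≤t = ≤ᵇ⇒≤ _ _ _
overlap-triangleᵇ false true Bool.f≤t = ≤ᵇ⇒≤ _ _ _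
overlap-triangleᵇ false false Bool.f≤t = ≤ᵇ⇒≤ _ _ _
overlap-triangleᵇ true true (Bool.b≤b {true}) = ≤ᵇ⇒≤ _ _ _
overlap-triangleᵇ true false (Bool.b≤b {true}) = ≤ᵇ⇒≤ _ _ _
overlap-triangleᵇ false true (Bool.b≤b {true}) = ≤ᵇ⇒≤ _ _ _
overlap-triangleᵇ false false (Bool.b≤b {true}) = ≤ᵇ⇒≤ _ _ _
overlap-triangleᵇ true true (Bool.b≤b {false}) = ≤ᵇ⇒≤ _ _ _
overlap-triangleᵇ true false (Bool.b≤b {false}) = ≤ᵇ⇒≤ _ _ _
overlap-triangleᵇ false true (Bool.b≤b {false}) = ≤ᵇ⇒≤ _ _ _
overlap-triangleᵇ false false (Bool.b≤b {false}) = ≤ᵇ⇒≤ _ _ _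

overlap-triangle : ∀ {n} (X Y Y′ Z : Subset n) → Pointwise Bool._≤_ Y Y′ →
  ∣ X ─ Z ∣ + ∑[ i < n ] (⟦ lookup (X △ Y) i ⟧ * ⟦ lookup (Z △ Y′) i ⟧) ≤ ∣ X ─ Y ∣ + ∣ Y′ ─ Z ∣
overlap-triangle {n} X Y Y′ Z Y≤Y′ = begin
  ∣ X ─ Z ∣ + sum shared
    ≡⟨ cong (λ k → k + sum shared) (∣p─q∣≡∑ X Z) ⟩
  ∑[ i < n ] ⟦ x i ∧ not (z i) ⟧ + sum shared
    ≡⟨ ∑-distrib-+ (λ i → ⟦ x i ∧ not (z i) ⟧) shared ⟨
  ∑[ i < n ] (⟦ x i ∧ not (z i) ⟧ + shared i)
    ≤⟨ ∑-mono-≤ pointwise ⟩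
  ∑[ i < n ] (⟦ x i ∧ not (y i) ⟧ + ⟦ y′ i ∧ not (z i) ⟧)
    ≡⟨ ∑-distrib-+ (λ i → ⟦ x i ∧ not (y i) ⟧) (λ i → ⟦ y′ i ∧ not (z i) ⟧) ⟩
  ∑[ i < n ] ⟦ x i ∧ not (y i) ⟧ + ∑[ i < n ] ⟦ y′ i ∧ not (z i) ⟧
    ≡⟨ cong₂ _+_ (∣p─q∣≡∑ X Y) (∣p─q∣≡∑ Y′ Z) ⟨
  ∣ X ─ Y ∣ + ∣ Y′ ─ Z ∣ ∎
  where
  open ≤-Reasoning
  x y y′ z : Fin n → Bool
  x = lookup X
  y = lookup Y
  y′ = lookup Y′
  z = lookup Z
  shared : Fin n → ℕ
  shared i = ⟦ lookup (X △ Y) i ⟧ * ⟦ lookup (Z △ Y′) i ⟧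
  pointwise : ∀ i → ⟦ x i ∧ not (z i) ⟧ + shared i ≤ ⟦ x i ∧ not (y i) ⟧ + ⟦ y′ i ∧ not (z i) ⟧
  pointwise i rewrite lookup-△ X Y i | lookup-△ Z Y′ i =
    overlap-triangleᵇ (x i) (z i) (Pointwise.lookup Y≤Y′ i)

triangle : ∀ {n} (X Y Y′ Z : Subset n) → Pointwise Bool._≤_ Y Y′ → ∣ X ─ Z ∣ ≤ ∣ X ─ Y ∣ + ∣ Y′ ─ Z ∣
triangle X Y Y′ Z Y≤Y′ = ≤-trans (m≤m+n ∣ X ─ Z ∣ _) (overlap-triangle X Y Y′ Z Y≤Y′)

disjoint-packing : ∀ {m n v} s (g : Fin m → Fin n → ℕ) (S : Fin m → Fin n → Subset v) →
  (∀ i j → g i j ≤ 1) → (∀ i j → g i j ≢ 0 → ∣ S i j ∣ ≡ s) →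
  (∀ p i j i′ j′ → g i j ≢ 0 → g i′ j′ ≢ 0 → lookup (S i j) p ≡ true → lookup (S i′ j′) p ≡ true →
                   i ≡ i′ × j ≡ j′) →
  (∑[ i < m ] ∑[ j < n ] g i j) * s ≤ v
disjoint-packing {m} {n} {v} s g S g≤1 ∣S∣≡s disjoint = begin
  (∑[ i < m ] ∑[ j < n ] g i j) * s
    ≡⟨ *-distribʳ-sum s (λ i → ∑[ j < n ] g i j) ⟩
  ∑[ i < m ] ((∑[ j < n ] g i j) * s)
    ≡⟨ sum-cong-≗ (λ i → *-distribʳ-sum s (g i)) ⟩
  ∑[ i < m ] ∑[ j < n ] (g i j * s)
    ≡⟨ sum-cong-≗ (λ i → sum-cong-≗ (g*s≡∑ i)) ⟩
  ∑[ i < m ] ∑[ j < n ] ∑[ p < v ] cover p i j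
    ≡⟨ sum-cong-≗ (λ i → ∑-comm (λ j p → cover p i j)) ⟩
  ∑[ i < m ] ∑[ p < v ] ∑[ j < n ] cover p i j
    ≡⟨ ∑-comm (λ i p → ∑[ j < n ] cover p i j) ⟩
  ∑[ p < v ] ∑[ i < m ] ∑[ j < n ] cover p i j
    ≤⟨ ∑-mono-≤ (λ p → ∑∑-≤-unique (cover p) (λ i j → *-mono-≤ (g≤1 i j) (⟦⟧≤1 _)) (covered-once p)) ⟩
  ∑[ p < v ] 1
    ≡⟨ trans (∑-const v 1) (*-identityʳ v) ⟩
  v ∎
  where
  open ≤-Reasoning
  cover : Fin v → Fin m → Fin n → ℕ
  cover p i j = g i j * ⟦ lookup (S i j) p ⟧
  covered-once : ∀ p i j i′ j′ → cover p i j ≢ 0 → cover p i′ j′ ≢ 0 → i ≡ i′ × j ≡ j′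
  covered-once p i j i′ j′ c≢0 c′≢0 = disjoint p i j i′ j′
    (≢0-*ˡ (g i j) _ c≢0) (≢0-*ˡ (g i′ j′) _ c′≢0)
    (⟦⟧≢0 _ (≢0-*ʳ (g i j) _ c≢0)) (⟦⟧≢0 _ (≢0-*ʳ (g i′ j′) _ c′≢0))
  g*s≡∑ : ∀ i j → g i j * s ≡ ∑[ p < v ] cover p i j
  g*s≡∑ i j with g i j ≟ 0
  ... | yes g≡0 rewrite g≡0 = sym (∑-zero {v} (λ _ → refl))
  ... | no g≢0 = begin-equality
    g i j * s              ≡⟨ cong (g i j *_) (∣S∣≡s i j g≢0) ⟨
    g i j * ∣ S i j ∣       ≡⟨ cong (g i j *_) (∣p∣≡∑ (S i j)) ⟩
    g i j * ∑[ p < v ] ⟦ lookup (S i j) p ⟧ ≡⟨ *-distribˡ-sum (g i j) (λ p → ⟦ lookup (S i j) p ⟧) ⟩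
    ∑[ p < v ] cover p i j ∎

-- The weight of a maximal chain

Separated : ℕ → ∀ {v n} → (Fin n → Subset v) → Set
Separated q B = ∀ i l → i ≢ l → q < ∣ B i ─ B l ∣

weight : ℕ → ℕ → Bool → ∀ {v} → Subset v → Subset v → ℕ
weight α r shell B Y = α * ball r B Y + ⟦ shell ⟧ * ball (suc r) B Y

weight≤ : ∀ α r shell {v} (B Y : Subset v) → weight α r shell B Y ≤ α + ⟦ shell ⟧
weight≤ α r shell B Y = +-mono-≤
  (≤-trans (*-monoʳ-≤ α (ball≤1 r B Y)) (≤-reflexive (*-identityʳ α)))
  (≤-trans (*-monoʳ-≤ ⟦ shell ⟧ (ball≤1 (suc r) B Y)) (≤-reflexive (*-identityʳ ⟦ shell ⟧)))

weight≢0 : ∀ α r shell {v} (B Y : Subset v) → weight α r shell B Y ≢ 0 →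
           ∣ B ─ Y ∣ ≡ ∣ Y ─ B ∣ × ∣ B ─ Y ∣ ≤ r + ⟦ shell ⟧
weight≢0 α r false B Y ≢0 = map₂ (λ ≤r → subst (∣ B ─ Y ∣ ≤_) (sym (+-identityʳ r)) ≤r) (ball≢0 r B Y ball≢0′)
  where
  ball≢0′ : ball r B Y ≢ 0
  ball≢0′ ≡0 = ≢0 (trans (cong (λ b → α * b + 0) ≡0) (trans (+-identityʳ (α * 0)) (*-zeroʳ α)))
weight≢0 α r true B Y ≢0 = map₂ (λ ≤1+r → subst (∣ B ─ Y ∣ ≤_) (+-comm 1 r) ≤1+r) (ball≢0 (suc r) B Y ball≢0′)
  where
  ball≢0′ : ball (suc r) B Y ≢ 0
  ball≢0′ ≡0 = ≢0 (trans (cong₂ (λ b b′ → α * b + (b′ + 0)) (m+n≡0⇒m≡0 (ball r B Y) ≡0) ≡0)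
                         (cong (_+ 0) (*-zeroʳ α)))

module ChainBound {v n} (B : Fin n → Subset v) (q r α : ℕ) (shell : Bool)
  (separated : Separated q B)
  (radius : r + r + ⟦ shell ⟧ ≤ q)
  (packing : shell ≡ true → ∀ t → t * (2 * suc r) ≤ v → t ≤ suc α)
  (c : Chain v) where

  Y : Fin (suc v) → Subset v
  Y = level c

  w : Fin (suc v) → Fin n → ℕ
  w j i = weight α r shell (B i) (Y j)

  separated-along-chain : ∀ {i l j j′} → i ≢ l → toℕ j ≤ toℕ j′ → q < ∣ B i ─ Y j ∣ + ∣ Y j′ ─ B l ∣
  separated-along-chain {i} {l} {j} {j′} i≢l j≤j′ =
    <-≤-trans (separated i l i≢l) (triangle (B i) (Y j) (Y j′) (B l) (level-mono c j≤j′))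

  same-level : ∀ {i j j′} → ∣ B i ─ Y j ∣ ≡ ∣ Y j ─ B i ∣ → ∣ B i ─ Y j′ ∣ ≡ ∣ Y j′ ─ B i ∣ → j ≡ j′
  same-level {i} {j} {j′} balanced balanced′ = Fin.toℕ-injective (begin
    toℕ j      ≡⟨ ∣level∣ c j ⟨
    ∣ Y j ∣    ≡⟨ ∣p─q∣≡∣q─p∣⇒∣q∣≡∣p∣ (B i) (Y j) balanced ⟩
    ∣ B i ∣    ≡⟨ ∣p─q∣≡∣q─p∣⇒∣q∣≡∣p∣ (B i) (Y j′) balanced′ ⟨
    ∣ Y j′ ∣   ≡⟨ ∣level∣ c j′ ⟩
    toℕ j′     ∎)
    where open ≡-Reasoning

  both≤ : ∀ {i j k} → ∣ B i ─ Y j ∣ ≡ ∣ Y j ─ B i ∣ × ∣ B i ─ Y j ∣ ≤ k →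
          ∣ B i ─ Y j ∣ ≤ k × ∣ Y j ─ B i ∣ ≤ k
  both≤ (balanced , ≤k) = ≤k , subst (_≤ _) balanced ≤k

  sum≤q : ∀ {a b} → a ≤ r → b ≤ r + ⟦ shell ⟧ → a + b ≤ q
  sum≤q a≤r b≤ = ≤-trans (+-mono-≤ a≤r b≤) (subst (_≤ q) (+-assoc r r ⟦ shell ⟧) radius)

  ball-exclusive : ∀ {i l j j′} → i ≢ l → ball r (B i) (Y j) ≢ 0 → w j′ l ≢ 0 → Data.Empty.⊥
  ball-exclusive {i} {l} {j} {j′} i≢l inBall hit with toℕ j ≤? toℕ j′
  ... | yes j≤j′ = <⇒≱ (separated-along-chain i≢l j≤j′) (sum≤q (proj₁ near) (proj₂ near′))
    where
    near = both≤ (ball≢0 r (B i) (Y j) inBall)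
    near′ = both≤ (weight≢0 α r shell (B l) (Y j′) hit)
  ... | no j≰j′ = <⇒≱ (separated-along-chain (i≢l ∘ sym) (≰⇒≥ j≰j′))
    (subst (_≤ q) (+-comm (∣ Y j ─ B i ∣) (∣ B l ─ Y j′ ∣)) (sum≤q (proj₂ near) (proj₁ near′)))
    where
    near = both≤ (ball≢0 r (B i) (Y j) inBall)
    near′ = both≤ (weight≢0 α r shell (B l) (Y j′) hit)

  shells-disjoint : ∀ {i i′ j j′} p → i ≢ i′ → toℕ j ≤ toℕ j′ → suc (r + r) ≤ q →
    ∣ B i ─ Y j ∣ ≡ suc r → ∣ Y j′ ─ B i′ ∣ ≡ suc r →
    lookup (B i △ Y j) p ≡ true → lookup (B i′ △ Y j′) p ≡ true → Data.Empty.⊥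
  shells-disjoint {i} {i′} {j} {j′} p i≢i′ j≤j′ 2r+1≤q d₁ d₂ p∈ p∈′ =
    1+n≰n (subst (_≤ 0) shared≡1 (subst (shared p ≤_) (n≤0⇒n≡0 (+-cancelˡ-≤ d _ 0 tight)) (term≤∑ shared p)))
    where
    shared : Fin v → ℕ
    shared p = ⟦ lookup (B i △ Y j) p ⟧ * ⟦ lookup (B i′ △ Y j′) p ⟧
    shared≡1 : shared p ≡ 1
    shared≡1 rewrite p∈ | p∈′ = refl
    d = ∣ B i ─ B i′ ∣
    tight : d + sum shared ≤ d + 0
    tight = begin
      d + sum shared                  ≤⟨ overlap-triangle (B i) (Y j) (Y j′) (B i′) (level-mono c j≤j′) ⟩
      ∣ B i ─ Y j ∣ + ∣ Y j′ ─ B i′ ∣ ≡⟨ cong₂ _+_ d₁ d₂ ⟩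
      suc r + suc r                   ≡⟨ cong suc (+-suc r r) ⟩
      suc (suc (r + r))               ≤⟨ s≤s 2r+1≤q ⟩
      suc q                           ≤⟨ separated i i′ i≢i′ ⟩
      d                               ≡⟨ +-identityʳ d ⟨
      d + 0                           ∎
      where open ≤-Reasoning

  total : ℕ
  total = ∑[ j < suc v ] ∑[ i < n ] w j i

  bound-with-ball : ∀ j₀ i₀ → ball r (B i₀) (Y j₀) ≢ 0 → total ≤ α + ⟦ shell ⟧
  bound-with-ball j₀ i₀ inBall = ∑∑-≤-unique w (λ j i → weight≤ α r shell (B i) (Y j)) unique
    where
    at-ball : ∀ {j i} → w j i ≢ 0 → j ≡ j₀ × i ≡ i₀
    at-ball {j} {i} hit with i Fin.≟ i₀
    ... | yes refl = same-level (proj₁ (weight≢0 α r shell (B i) (Y j) hit)) (proj₁ (ball≢0 r _ _ inBall)) , refl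
    ... | no i≢i₀ = ⊥-elim (ball-exclusive (i≢i₀ ∘ sym) inBall hit)
    unique : ∀ j i j′ i′ → w j i ≢ 0 → w j′ i′ ≢ 0 → j ≡ j′ × i ≡ i′
    unique j i j′ i′ hit hit′ with at-ball hit | at-ball hit′
    ... | refl , refl | refl , refl = refl , refl

  module _ (noBall : ∀ j i → ball r (B i) (Y j) ≡ 0) where

    w≡shell*sphere : ∀ j i → w j i ≡ ⟦ shell ⟧ * sphere (suc r) (B i) (Y j)
    w≡shell*sphere j i = trans
      (cong₂ (λ b b′ → α * b + ⟦ shell ⟧ * (b′ + sphere (suc r) (B i) (Y j))) (noBall j i) (noBall j i))
      (cong (_+ ⟦ shell ⟧ * sphere (suc r) (B i) (Y j)) (*-zeroʳ α))

    spheres-packed : shell ≡ true → total * (2 * suc r) ≤ v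
    spheres-packed shell≡true =
      disjoint-packing (2 * suc r) w (λ j i → B i △ Y j) w≤1 size disjoint
      where
      w≡sphere : ∀ j i → w j i ≡ sphere (suc r) (B i) (Y j)
      w≡sphere j i = trans (w≡shell*sphere j i)
        (trans (cong (λ b → ⟦ b ⟧ * sphere (suc r) (B i) (Y j)) shell≡true) (+-identityʳ _))
      w≤1 : ∀ j i → w j i ≤ 1
      w≤1 j i = subst (_≤ 1) (sym (w≡sphere j i)) (sphere≤1 (suc r) (B i) (Y j))
      on-sphere : ∀ {j i} → w j i ≢ 0 → ∣ B i ─ Y j ∣ ≡ suc r × ∣ Y j ─ B i ∣ ≡ suc r
      on-sphere {j} {i} hit = sphere≢0 (suc r) (B i) (Y j) (λ ≡0 → hit (trans (w≡sphere j i) ≡0))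
      size : ∀ j i → w j i ≢ 0 → ∣ B i △ Y j ∣ ≡ 2 * suc r
      size j i hit = begin
        ∣ B i △ Y j ∣               ≡⟨ ∣p△q∣≡∣p─q∣+∣q─p∣ (B i) (Y j) ⟩
        ∣ B i ─ Y j ∣ + ∣ Y j ─ B i ∣ ≡⟨ cong₂ _+_ (proj₁ (on-sphere hit)) (proj₂ (on-sphere hit)) ⟩
        suc r + suc r               ≡⟨ cong (_+_ (suc r)) (+-identityʳ (suc r)) ⟨
        2 * suc r                   ∎
        where open ≡-Reasoning
      2r+1≤q : suc (r + r) ≤ q
      2r+1≤q = subst (_≤ q) (trans (cong (λ b → r + r + ⟦ b ⟧) shell≡true) (+-comm (r + r) 1)) radius
      disjoint : ∀ p j i j′ i′ → w j i ≢ 0 → w j′ i′ ≢ 0 →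
                 lookup (B i △ Y j) p ≡ true → lookup (B i′ △ Y j′) p ≡ true → j ≡ j′ × i ≡ i′
      disjoint p j i j′ i′ hit hit′ p∈ p∈′ with i Fin.≟ i′ | toℕ j ≤? toℕ j′
      ... | yes refl | _ = same-level (balanced hit) (balanced hit′) , refl
        where
        balanced : ∀ {j} → w j i ≢ 0 → ∣ B i ─ Y j ∣ ≡ ∣ Y j ─ B i ∣
        balanced h = let (d₁ , d₂) = on-sphere h in trans d₁ (sym d₂)
      ... | no i≢i′ | yes j≤j′ = ⊥-elim
        (shells-disjoint p i≢i′ j≤j′ 2r+1≤q (proj₁ (on-sphere hit)) (proj₂ (on-sphere hit′)) p∈ p∈′)
      ... | no i≢i′ | no j≰j′ = ⊥-elim
        (shells-disjoint p (i≢i′ ∘ sym) (≰⇒≥ j≰j′) 2r+1≤q (proj₁ (on-sphere hit′)) (proj₂ (on-sphere hit)) p∈′ p∈)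

    bound-without-ball : total ≤ α + ⟦ shell ⟧
    bound-without-ball with shell Bool.≟ true
    ... | yes shell≡true = subst (λ b → total ≤ α + ⟦ b ⟧) (sym shell≡true)
      (subst (total ≤_) (+-comm 1 α) (packing shell≡true total (spheres-packed shell≡true)))
    ... | no shell≢true = ≤-trans (≤-reflexive total≡0) z≤n
      where
      total≡0 : total ≡ 0
      total≡0 = ∑-zero λ j → ∑-zero λ i →
        trans (w≡shell*sphere j i) (cong (λ b → ⟦ b ⟧ * sphere (suc r) (B i) (Y j)) (¬-not shell≢true))

  chain-bound : total ≤ α + ⟦ shell ⟧
  chain-bound with any? (λ j → any? (λ i → ¬? (ball r (B i) (Y j) ≟ 0)))
  ... | yes (j₀ , i₀ , inBall) = bound-with-ball j₀ i₀ inBall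
  ... | no noHit = bound-without-ball noBall
    where
    noBall : ∀ j i → ball r (B i) (Y j) ≡ 0
    noBall j i = decidable-stable (ball r (B i) (Y j) ≟ 0) (λ ≢0 → noHit (j , i , ≢0))

-- Minimisation over the levels

ballWeight : ℕ → ℕ → Bool → ℕ → ℕ → ℕ
ballWeight α r shell a b = α * ballSize r a b + ⟦ shell ⟧ * ballSize (suc r) a b

∑ₛ-weight : ∀ α r shell {v} (B : Subset v) →
  ∑ₛ (λ Y → weight α r shell B Y * chainsThrough Y) ≡ chainsThrough B * ballWeight α r shell (∣ B ∣) (∣ ∁ B ∣)
∑ₛ-weight α r shell B = begin
  ∑ₛ (λ Y → (α * ball r B Y + s * ball (suc r) B Y) * chainsThrough Y)
    ≡⟨ ∑ₛ-cong (λ Y → distrib α (ball r B Y) s (ball (suc r) B Y) (chainsThrough Y)) ⟩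
  ∑ₛ (λ Y → α * (ball r B Y * chainsThrough Y) + s * (ball (suc r) B Y * chainsThrough Y))
    ≡⟨ ∑ₛ-distrib-+ (λ Y → α * (ball r B Y * chainsThrough Y)) (λ Y → s * (ball (suc r) B Y * chainsThrough Y)) ⟩
  ∑ₛ (λ Y → α * (ball r B Y * chainsThrough Y)) + ∑ₛ (λ Y → s * (ball (suc r) B Y * chainsThrough Y))
    ≡⟨ cong₂ _+_ (*-distribˡ-∑ₛ α (λ Y → ball r B Y * chainsThrough Y))
                 (*-distribˡ-∑ₛ s (λ Y → ball (suc r) B Y * chainsThrough Y)) ⟨
  α * ∑ₛ (λ Y → ball r B Y * chainsThrough Y) + s * ∑ₛ (λ Y → ball (suc r) B Y * chainsThrough Y)
    ≡⟨ cong₂ (λ x y → α * x + s * y) (∑ₛ-ball B r) (∑ₛ-ball B (suc r)) ⟩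
  α * (F * ballSize r a b) + s * (F * ballSize (suc r) a b)
    ≡⟨ factor α F (ballSize r a b) s (ballSize (suc r) a b) ⟩
  F * ballWeight α r shell a b ∎
  where
  open ≡-Reasoning
  s = ⟦ shell ⟧
  a = ∣ B ∣
  b = ∣ ∁ B ∣
  F = chainsThrough B
  distrib : ∀ α x s y f → (α * x + s * y) * f ≡ α * (x * f) + s * (y * f)
  distrib = solve-∀
  factor : ∀ α f x s y → α * (f * x) + s * (f * y) ≡ f * (α * x + s * y)
  factor = solve-∀

absorption : ∀ n k → suc k * (n C suc k) + k * (n C k) ≡ n * (n C k)
absorption zero zero = refl
absorption zero (suc k) = cong₂ _+_ (*-zeroʳ (suc (suc k))) (*-zeroʳ (suc k))
absorption (suc n) zero = trans (+-identityʳ _) (trans (+-identityʳ _) (trans (nC1≡n (suc n)) (sym (*-identityʳ (suc n)))))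
absorption (suc n) (suc k) = begin
  suc (suc k) * (suc n C suc (suc k)) + suc k * (suc n C suc k)
    ≡⟨ cong₂ (λ x y → suc (suc k) * x + suc k * y) (sym (nCk+nC[k+1]≡[n+1]C[k+1] n (suc k)))
                                                   (sym (nCk+nC[k+1]≡[n+1]C[k+1] n k)) ⟩
  suc (suc k) * (c₁ + c₂) + suc k * (c₀ + c₁)
    ≡⟨ regroup k c₀ c₁ c₂ ⟩
  (suc (suc k) * c₂ + suc k * c₁) + (suc k * c₁ + k * c₀) + (c₀ + c₁)
    ≡⟨ cong₂ (λ x y → x + y + (c₀ + c₁)) (absorption n (suc k)) (absorption n k) ⟩
  n * c₁ + n * c₀ + (c₀ + c₁)
    ≡⟨ collect n c₀ c₁ ⟩
  suc n * (c₀ + c₁)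
    ≡⟨ cong (suc n *_) (nCk+nC[k+1]≡[n+1]C[k+1] n k) ⟩
  suc n * (suc n C suc k) ∎
  where
  open ≡-Reasoning
  c₀ = n C k
  c₁ = n C suc k
  c₂ = n C suc (suc k)
  regroup : ∀ k c₀ c₁ c₂ → suc (suc k) * (c₁ + c₂) + suc k * (c₀ + c₁)
                         ≡ (suc (suc k) * c₂ + suc k * c₁) + (suc k * c₁ + k * c₀) + (c₀ + c₁)
  regroup = solve-∀
  collect : ∀ n c₀ c₁ → n * c₁ + n * c₀ + (c₀ + c₁) ≡ suc n * (c₀ + c₁)
  collect = solve-∀

-- Multiplying by r + 1 turns both sides into multiples of C(a,r) C(a+d,r), by absorption.
binomial-exchange : ∀ r a d →
  d * (a C r) * ((a + d) C r) + suc (a + d) * (a C suc r) * ((a + d) C r) ≡ suc a * (a C r) * ((a + d) C suc r)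
binomial-exchange r a d = *-cancelˡ-≡ _ _ (suc r) (+-cancelʳ-≡ (suc (a + d) * r * X * Y) _ _ (begin
  suc r * (d * X * Y + suc (a + d) * X′ * Y) + suc (a + d) * r * X * Y
    ≡⟨ step₁ r a d X Y X′ ⟩
  d * suc r * X * Y + suc (a + d) * ((suc r * X′ + r * X) * Y)
    ≡⟨ cong (λ z → d * suc r * X * Y + suc (a + d) * (z * Y)) (absorption a r) ⟩
  d * suc r * X * Y + suc (a + d) * (a * X * Y)
    ≡⟨ step₂ r a d X Y ⟩
  suc a * X * ((a + d) * Y) + d * r * X * Y
    ≡⟨ cong (λ z → suc a * X * z + d * r * X * Y) (absorption (a + d) r) ⟨
  suc a * X * (suc r * Y′ + r * Y) + d * r * X * Y
    ≡⟨ step₃ r a d X Y Y′ ⟩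
  suc r * (suc a * X * Y′) + suc (a + d) * r * X * Y ∎))
  where
  open ≡-Reasoning
  X = a C r
  Y = (a + d) C r
  X′ = a C suc r
  Y′ = (a + d) C suc r
  step₁ : ∀ r a d X Y X′ → suc r * (d * X * Y + suc (a + d) * X′ * Y) + suc (a + d) * r * X * Y
                         ≡ d * suc r * X * Y + suc (a + d) * ((suc r * X′ + r * X) * Y)
  step₁ = solve-∀
  step₂ : ∀ r a d X Y → d * suc r * X * Y + suc (a + d) * (a * X * Y) ≡ suc a * X * ((a + d) * Y) + d * r * X * Y
  step₂ = solve-∀
  step₃ : ∀ r a d X Y Y′ → suc a * X * (suc r * Y′ + r * Y) + d * r * X * Y
                         ≡ suc r * (suc a * X * Y′) + suc (a + d) * r * X * Y
  step₃ = solve-∀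

ballSize-shift : ∀ r a d →
  suc (a + d) * ballSize r a (suc (a + d)) ≡ suc a * ballSize r (suc a) (a + d) + d * ((a C r) * ((a + d) C r))
ballSize-shift zero a d = base a d
  where
  base : ∀ a d → suc (a + d) * 1 ≡ suc a * 1 + d * 1
  base = solve-∀
ballSize-shift (suc r) a d = begin
  suc c * (ballSize r a (suc c) + X′ * (suc c C suc r))
    ≡⟨ cong (λ z → suc c * (ballSize r a (suc c) + X′ * z)) (nCk+nC[k+1]≡[n+1]C[k+1] c r) ⟨
  suc c * (ballSize r a (suc c) + X′ * (Y + Y′))
    ≡⟨ *-distribˡ-+ (suc c) (ballSize r a (suc c)) _ ⟩
  suc c * ballSize r a (suc c) + suc c * (X′ * (Y + Y′))
    ≡⟨ cong (_+ suc c * (X′ * (Y + Y′))) (ballSize-shift r a d) ⟩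
  suc a * S + d * (X * Y) + suc c * (X′ * (Y + Y′))
    ≡⟨ step₁ (suc a * S) d X Y X′ Y′ c ⟩
  suc a * S + (d * X * Y + suc c * X′ * Y) + suc c * X′ * Y′
    ≡⟨ cong (λ z → suc a * S + z + suc c * X′ * Y′) (binomial-exchange r a d) ⟩
  suc a * S + suc a * X * Y′ + suc c * X′ * Y′
    ≡⟨ step₂ a d S X X′ Y′ ⟩
  suc a * (S + (X + X′) * Y′) + d * (X′ * Y′)
    ≡⟨ cong (λ z → suc a * (S + z * Y′) + d * (X′ * Y′)) (nCk+nC[k+1]≡[n+1]C[k+1] a r) ⟩
  suc a * (S + (suc a C suc r) * Y′) + d * (X′ * Y′) ∎
  where
  open ≡-Reasoning
  c = a + d
  X = a C r
  Y = c C r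
  X′ = a C suc r
  Y′ = c C suc r
  S = ballSize r (suc a) c
  step₁ : ∀ p d X Y X′ Y′ c → p + d * (X * Y) + suc c * (X′ * (Y + Y′))
                            ≡ p + (d * X * Y + suc c * X′ * Y) + suc c * X′ * Y′
  step₁ = solve-∀
  step₂ : ∀ a d S X X′ Y′ → suc a * S + suc a * X * Y′ + suc (a + d) * X′ * Y′
                          ≡ suc a * (S + (X + X′) * Y′) + d * (X′ * Y′)
  step₂ = solve-∀

ballSize-sym : ∀ r a b → ballSize r a b ≡ ballSize r b a
ballSize-sym zero a b = refl
ballSize-sym (suc r) a b = cong₂ _+_ (ballSize-sym r a b) (*-comm (a C suc r) (b C suc r))

ballSize-balance : ∀ r a d → suc a * ballSize r (suc a) (a + d) ≤ suc (a + d) * ballSize r a (suc (a + d))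
ballSize-balance r a d = ≤-trans (m≤m+n _ _) (≤-reflexive (sym (ballSize-shift r a d)))

ballWeight-balance : ∀ α r shell a d →
  suc a * ballWeight α r shell (suc a) (a + d) ≤ suc (a + d) * ballWeight α r shell a (suc (a + d))
ballWeight-balance α r shell a d = subst₂ _≤_ (distrib (suc a) α ⟦ shell ⟧ _ _) (distrib (suc (a + d)) α ⟦ shell ⟧ _ _)
  (+-mono-≤ (*-monoʳ-≤ α (ballSize-balance r a d)) (*-monoʳ-≤ ⟦ shell ⟧ (ballSize-balance (suc r) a d)))
  where
  distrib : ∀ x α s p p′ → α * (x * p) + s * (x * p′) ≡ x * (α * p + s * p′)
  distrib = solve-∀

-- Total weight, over all maximal chains, of a code word B with ∣ B ∣ = a and ∣ ∁ B ∣ = b.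
contribution : ℕ → ℕ → Bool → ℕ → ℕ → ℕ
contribution α r shell a b = a ! * b ! * ballWeight α r shell a b

contribution-sym : ∀ α r shell a b → contribution α r shell a b ≡ contribution α r shell b a
contribution-sym α r shell a b = cong₂ _*_ (*-comm (a !) (b !))
  (cong₂ (λ x y → α * x + ⟦ shell ⟧ * y) (ballSize-sym r a b) (ballSize-sym (suc r) a b))

contribution-balance : ∀ α r shell a d →
  contribution α r shell (suc a) (a + d) ≤ contribution α r shell a (suc (a + d))
contribution-balance α r shell a d = subst₂ _≤_ (reassoc₁ (suc a) (a !) ((a + d) !) _) (reassoc₂ (suc (a + d)) (a !) ((a + d) !) _)
  (*-monoʳ-≤ (a ! * (a + d) !) (ballWeight-balance α r shell a d))
  where
  reassoc₁ : ∀ x f g w → f * g * (x * w) ≡ x * f * g * w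
  reassoc₁ = solve-∀
  reassoc₂ : ∀ x f g w → f * g * (x * w) ≡ f * (x * g) * w
  reassoc₂ = solve-∀

halves : ∀ a k → k < 2 → (a + (a + k)) / 2 ≡ a × (a + (a + k)) ∸ (a + (a + k)) / 2 ≡ a + k
halves a k k<2 = half , trans (cong ((a + (a + k)) ∸_) half) (m+n∸m≡n a (a + k))
  where
  shape : ∀ a k → a + (a + k) ≡ k + a * 2
  shape = solve-∀
  half : (a + (a + k)) / 2 ≡ a
  half = trans (/-congˡ (shape a k))
    (trans (+-distrib-/-∣ʳ k (divides a refl)) (cong₂ _+_ (m<n⇒m/n≡0 k<2) (m*n/n≡m a 2)))

contribution-middle′ : ∀ α r shell {v} d a → a + (a + d) ≡ v →
  contribution α r shell (v / 2) (v ∸ v / 2) ≤ contribution α r shell a (a + d)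
contribution-middle′ α r shell zero a refl =
  ≤-reflexive (cong₂ (contribution α r shell) (proj₁ (halves a 0 (s≤s z≤n))) (proj₂ (halves a 0 (s≤s z≤n))))
contribution-middle′ α r shell (suc zero) a refl =
  ≤-reflexive (cong₂ (contribution α r shell) (proj₁ (halves a 1 ≤-refl)) (proj₂ (halves a 1 ≤-refl)))
contribution-middle′ α r shell (suc (suc d)) a a+[a+d]≡v = ≤-trans
  (contribution-middle′ α r shell d (suc a) (trans (shift a d) a+[a+d]≡v))
  (subst₂ (λ x y → contribution α r shell (suc a) x ≤ contribution α r shell a y)
          (+-suc a d) (sym (+-suc a (suc d))) (contribution-balance α r shell a (suc d)))
  where
  shift : ∀ a d → suc a + (suc a + d) ≡ a + (a + suc (suc d))
  shift = solve-∀

contribution-middle : ∀ α r shell {v} a b → a + b ≡ v →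
  contribution α r shell (v / 2) (v ∸ v / 2) ≤ contribution α r shell a b
contribution-middle α r shell {v} a b a+b≡v with a ≤? b
... | yes a≤b = subst (λ x → V (v / 2) (v ∸ v / 2) ≤ V a x) (m+[n∸m]≡n a≤b)
  (contribution-middle′ α r shell (b ∸ a) a (trans (cong (_+_ a) (m+[n∸m]≡n a≤b)) a+b≡v))
  where V = contribution α r shell
... | no a≰b = subst (V (v / 2) (v ∸ v / 2) ≤_) (contribution-sym α r shell b a)
  (subst (λ x → V (v / 2) (v ∸ v / 2) ≤ V b x) (m+[n∸m]≡n (≰⇒≥ a≰b))
    (contribution-middle′ α r shell (a ∸ b) b (trans (cong (_+_ b) (m+[n∸m]≡n (≰⇒≥ a≰b))) (trans (+-comm b a) a+b≡v))))
  where V = contribution α r shell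

k![n∸k]!*nCk≡n! : ∀ {n k} → k ≤ n → k ! * (n ∸ k) ! * (n C k) ≡ n !
k![n∸k]!*nCk≡n! {n} {k} k≤n = trans (cong (k ! * (n ∸ k) ! *_) (nCk≡n!/k![n-k]! k≤n))
                                    (m*[n/m]≡n {{k !* (n ∸ k) !≢0}} (k![n∸k]!∣n! k≤n))

weighted-bound : ∀ {v n} (B : Fin n → Subset v) q r α shell →
  Separated q B → r + r + ⟦ shell ⟧ ≤ q →
  (shell ≡ true → ∀ t → t * (2 * suc r) ≤ v → t ≤ suc α) →
  n * ballWeight α r shell (v / 2) (v ∸ v / 2) ≤ (v C (v / 2)) * (α + ⟦ shell ⟧)
weighted-bound {v} {n} B q r α shell separated radius packing =
  *-cancelˡ-≤ (m ! * (v ∸ m) !) {{m !* (v ∸ m) !≢0}} (begin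
    m ! * (v ∸ m) ! * (n * ballWeight α r shell m (v ∸ m))
      ≡⟨ swap (m ! * (v ∸ m) !) n _ ⟩
    n * contribution α r shell m (v ∸ m)
      ≡⟨ ∑-const n _ ⟨
    ∑[ i < n ] contribution α r shell m (v ∸ m)
      ≤⟨ ∑-mono-≤ (λ i → contribution-middle α r shell (∣ B i ∣) (∣ ∁ (B i) ∣) (∣p∣+∣∁p∣≡n (B i))) ⟩
    ∑[ i < n ] contribution α r shell (∣ B i ∣) (∣ ∁ (B i) ∣)
      ≡⟨ sum-cong-≗ (λ i → ∑ₛ-weight α r shell (B i)) ⟨
    ∑[ i < n ] ∑ₛ (λ Y → weight α r shell (B i) Y * chainsThrough Y)
      ≡⟨ ∑ₛ-∑-comm (λ Y i → weight α r shell (B i) Y * chainsThrough Y) ⟨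
    ∑ₛ (λ Y → ∑[ i < n ] (weight α r shell (B i) Y * chainsThrough Y))
      ≡⟨ ∑ₛ-cong (λ Y → *-distribʳ-sum (chainsThrough Y) (λ i → weight α r shell (B i) Y)) ⟨
    ∑ₛ (λ Y → W Y * chainsThrough Y)
      ≤⟨ lubell W (α + ⟦ shell ⟧) (ChainBound.chain-bound B q r α shell separated radius packing) ⟩
    v ! * (α + ⟦ shell ⟧)
      ≡⟨ cong (_* (α + ⟦ shell ⟧)) (k![n∸k]!*nCk≡n! (m/n≤m v 2)) ⟨
    m ! * (v ∸ m) ! * (v C m) * (α + ⟦ shell ⟧)
      ≡⟨ *-assoc (m ! * (v ∸ m) !) (v C m) _ ⟩
    m ! * (v ∸ m) ! * ((v C m) * (α + ⟦ shell ⟧)) ∎)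
  where
  open ≤-Reasoning
  m = v / 2
  W : Subset v → ℕ
  W Y = ∑[ i < n ] weight α r shell (B i) Y
  swap : ∀ f n w → f * (n * w) ≡ n * (f * w)
  swap = solve-∀

-- Separation in a (1, q)-solution

⋁ : ∀ {n} → (Fin n → Bool) → Bool
⋁ {zero} f = false
⋁ {suc n} f = f zero ∨ ⋁ (f ∘ suc)

lookup-⋃-map : ∀ {v m} (f : Fin m → Subset v) js p →
               lookup (⋃ (List.map f js)) p ≡ any (λ j → lookup (f j) p) js
lookup-⋃-map f [] p = lookup-replicate p false
lookup-⋃-map f (j ∷ js) p = trans (lookup-zipWith _∨_ p (f j) _) (cong (_∨_ (lookup (f j) p)) (lookup-⋃-map f js p))

does-∈? : ∀ {n} (x : Fin n) (p : Subset n) → does (x ∈? p) ≡ lookup p x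
does-∈? zero (true ∷ p) = refl
does-∈? zero (false ∷ p) = refl
does-∈? (suc x) (_ ∷ p) = does-∈? x p

any-filter-∈ : ∀ {n} (A : Subset n) (g : Fin n → Bool) js →
               any g (List.filter (_∈? A) js) ≡ any (λ j → lookup A j ∧ g j) js
any-filter-∈ A g [] = refl
any-filter-∈ A g (j ∷ js) with does (j ∈? A) | lookup A j | does-∈? j A
... | false | .false | refl = any-filter-∈ A g js
... | true | .true | refl = cong (_∨_ (g j)) (any-filter-∈ A g js)

any-tabulate : ∀ {A : Set} {n} (g : A → Bool) (f : Fin n → A) → any g (List.tabulate f) ≡ ⋁ (g ∘ f)
any-tabulate {n = zero} g f = refl
any-tabulate {n = suc n} g f = cong (_∨_ (g (f zero))) (any-tabulate g (f ∘ suc))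

lookup-φ : ∀ {v n} (B : Vec (Subset v) n) A p → lookup (φ B A) p ≡ ⋁ (λ j → lookup A j ∧ lookup (lookup B j) p)
lookup-φ {n = n} B A p = trans (lookup-⋃-map (lookup B) (List.filter (_∈? A) (List.allFin n)) p)
  (trans (any-filter-∈ A (λ j → lookup (lookup B j) p) (List.allFin n)) (any-tabulate (λ j → lookup A j ∧ lookup (lookup B j) p) (λ j → j)))

⋁-⊥ : ∀ {n} (g : Fin n → Bool) → ⋁ (λ j → lookup (⊥ {n}) j ∧ g j) ≡ false
⋁-⊥ {zero} g = refl
⋁-⊥ {suc n} g = ⋁-⊥ (g ∘ suc)

⋁-⁅⁆ : ∀ {n} (l : Fin n) (g : Fin n → Bool) → ⋁ (λ j → lookup ⁅ l ⁆ j ∧ g j) ≡ g l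
⋁-⁅⁆ zero g = trans (cong (_∨_ (g zero)) (⋁-⊥ (g ∘ suc))) (∨-identityʳ (g zero))
⋁-⁅⁆ (suc l) g = ⋁-⁅⁆ l (g ∘ suc)

⋁-∪ : ∀ {n} (p q : Subset n) (g : Fin n → Bool) →
      ⋁ (λ j → lookup (p ∪ q) j ∧ g j) ≡ ⋁ (λ j → lookup p j ∧ g j) ∨ ⋁ (λ j → lookup q j ∧ g j)
⋁-∪ [] [] g = refl
⋁-∪ (x ∷ p) (y ∷ q) g = trans (cong₂ _∨_ (∧-distribʳ-∨ (g zero) x y) (⋁-∪ p q (g ∘ suc)))
                              (∨-interchange (x ∧ g zero) (y ∧ g zero) _ _)

xor-∨ : ∀ x y → x xor (x ∨ y) ≡ y ∧ not x
xor-∨ true y = sym (∧-zeroʳ y)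
xor-∨ false y = sym (∧-identityʳ y)

solution-separated : ∀ {v n q} (B : Vec (Subset v) n) → InS v 1 q B → Separated q (lookup B)
solution-separated {v} {n} {q} B inS i l i≢l =
  subst (q <_) size (inS ⁅ l ⁆ (⁅ l ⁆ ∪ ⁅ i ⁆) distinct (≤-reflexive (∣⁅x⁆∣≡1 l)))
  where
  b : Fin n → Fin v → Bool
  b j = lookup (lookup B j)
  distinct : ⁅ l ⁆ ≢ ⁅ l ⁆ ∪ ⁅ i ⁆
  distinct eq = i≢l (x∈⁅y⁆⇒x≡y l (subst (i ∈_) (sym eq) (q⊆p∪q ⁅ l ⁆ ⁅ i ⁆ (x∈⁅x⁆ i))))
  pointwise : ∀ p → ⟦ lookup (φ B ⁅ l ⁆ △ φ B (⁅ l ⁆ ∪ ⁅ i ⁆)) p ⟧ ≡ ⟦ b i p ∧ not (b l p) ⟧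
  pointwise p rewrite lookup-△ (φ B ⁅ l ⁆) (φ B (⁅ l ⁆ ∪ ⁅ i ⁆)) p
                    | lookup-φ B ⁅ l ⁆ p | lookup-φ B (⁅ l ⁆ ∪ ⁅ i ⁆) p
                    | ⋁-∪ ⁅ l ⁆ ⁅ i ⁆ (λ j → b j p) | ⋁-⁅⁆ l (λ j → b j p) | ⋁-⁅⁆ i (λ j → b j p) =
    cong ⟦_⟧ (xor-∨ (b l p) (b i p))
  size : ∣ φ B ⁅ l ⁆ △ φ B (⁅ l ⁆ ∪ ⁅ i ⁆) ∣ ≡ ∣ lookup B i ─ lookup B l ∣
  size = trans (∣p∣≡∑ (φ B ⁅ l ⁆ △ φ B (⁅ l ⁆ ∪ ⁅ i ⁆))) (trans (sum-cong-≗ pointwise) (sym (∣p─q∣≡∑ (lookup B i) (lookup B l))))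

parity : ∀ q → (q % 2 ≡ 0 × q ≡ q / 2 + q / 2) ⊎ (q % 2 ≡ 1 × q ≡ suc (q / 2 + q / 2))
parity q with q % 2 in q%2≡ | m%n<n q 2
... | zero | _ = inj₁ (refl , trans (m≡m%n+[m/n]*n q 2) (trans (cong (_+ q / 2 * 2) q%2≡) (double (q / 2))))
  where
  double : ∀ x → x * 2 ≡ x + x
  double = solve-∀
... | suc zero | _ = inj₂ (refl , trans (m≡m%n+[m/n]*n q 2) (trans (cong (_+ q / 2 * 2) q%2≡) (double (q / 2))))
  where
  double : ∀ x → 1 + x * 2 ≡ suc (x + x)
  double = solve-∀
... | suc (suc _) | s≤s (s≤s ())

K-even : ∀ v q → q % 2 ≡ 0 → K v q ≡ (+ Keven v (q / 2)) ℚ./ 1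
K-even v q q%2≡0 with q % 2
K-even v q refl | .0 = refl

K-odd : ∀ v q → q % 2 ≡ 1 → K v q ≡ (+ Keven v (q / 2)) ℚ./ 1 ℚ.+ oddTerm v q
K-odd v q q%2≡1 with q % 2
K-odd v q refl | .1 = refl

oddTerm-zero : ∀ v q → (2 * ⌊v/2⌋ v) / suc q ≡ 0 → oddTerm v q ≡ ℚ.0ℚ
oddTerm-zero v q T≡0 with (2 * ⌊v/2⌋ v) / suc q
oddTerm-zero v q refl | .0 = refl

oddTerm-suc : ∀ v q t → (2 * ⌊v/2⌋ v) / suc q ≡ suc t →
  oddTerm v q ≡ (+ ((⌊v/2⌋ v C (suc q / 2)) * (⌈v/2⌉ v C (suc q / 2)))) ℚ./ suc t
oddTerm-suc v q t T≡1+t with (2 * ⌊v/2⌋ v) / suc q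
oddTerm-suc v q t refl | .(suc t) = refl

Keven≡ballSize : ∀ v r → Keven v r ≡ ballSize r (⌊v/2⌋ v) (⌈v/2⌉ v)
Keven≡ballSize v zero = refl
Keven≡ballSize v (suc r) = cong (_+ (⌊v/2⌋ v C suc r) * (⌈v/2⌉ v C suc r)) (Keven≡ballSize v r)

Keven-bound : ∀ {v n} (B : Fin n → Subset v) q r → Separated q B →
             r + r ≤ q → n * Keven v r ≤ v C ⌊v/2⌋ v
Keven-bound {v} {n} B q r separated r+r≤q = subst₂ _≤_
  (cong (n *_) (trans (+-identityʳ _) (trans (*-identityˡ _) (sym (Keven≡ballSize v r)))))
  (*-identityʳ _)
  (weighted-bound B q r 1 false separated (subst (_≤ q) (sym (+-identityʳ (r + r))) r+r≤q) (λ ()))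

≤/⇒*≤ : ∀ x k y .{{_ : NonZero k}} → x * k ≤ y → x ≤ y / k
≤/⇒*≤ x k y x*k≤y = subst (_≤ y / k) (m*n/n≡m x k) (/-monoˡ-≤ k x*k≤y)

Kodd-bound : ∀ {v n} (B : Fin n → Subset v) q r t → Separated q B →
  q ≡ suc (r + r) → (2 * ⌊v/2⌋ v) / suc q ≡ suc t →
  n * (Keven v r * suc t + (⌊v/2⌋ v C (suc q / 2)) * (⌈v/2⌉ v C (suc q / 2))) ≤ (v C ⌊v/2⌋ v) * suc t
Kodd-bound {v} {n} B q r t separated q≡ T≡ = subst₂ _≤_
  (trans (regroup n S G t) (cong₂ (λ x y → n * (x * suc t + (⌊v/2⌋ v C y) * (⌈v/2⌉ v C y))) (sym (Keven≡ballSize v r)) (sym half)))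
  (cong ((v C ⌊v/2⌋ v) *_) (+-comm t 1))
  (weighted-bound B q r t true separated radius packing)
  where
  S = ballSize r (⌊v/2⌋ v) (⌈v/2⌉ v)
  G = (⌊v/2⌋ v C suc r) * (⌈v/2⌉ v C suc r)
  regroup : ∀ n S G t → n * (t * S + ((S + G) + 0)) ≡ n * (S * suc t + G)
  regroup = solve-∀
  1+q≡2[1+r] : suc q ≡ 2 * suc r
  1+q≡2[1+r] = trans (cong suc q≡) (shape r)
    where
    shape : ∀ r → suc (suc (r + r)) ≡ 2 * suc r
    shape = solve-∀
  half : suc q / 2 ≡ suc r
  half = trans (cong (_/ 2) (trans 1+q≡2[1+r] (*-comm 2 (suc r)))) (m*n/n≡m (suc r) 2)
  radius : r + r + 1 ≤ q
  radius = ≤-reflexive (trans (+-comm (r + r) 1) (sym q≡))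
  packing : true ≡ true → ∀ t′ → t′ * (2 * suc r) ≤ v → t′ ≤ suc t
  packing _ t′ t′[2+2r]≤v = subst (t′ ≤_) T≡ (≤/⇒*≤ t′ (suc q) (2 * ⌊v/2⌋ v) (begin
    t′ * suc q           ≡⟨ cong (t′ *_) 1+q≡2[1+r] ⟩
    t′ * (2 * suc r)     ≡⟨ swap t′ (suc r) ⟩
    2 * (t′ * suc r)     ≤⟨ *-monoʳ-≤ 2 (≤/⇒*≤ (t′ * suc r) 2 v (subst (_≤ v) (swap′ t′ (suc r)) t′[2+2r]≤v)) ⟩
    2 * ⌊v/2⌋ v          ∎))
    where
    open ≤-Reasoning
    swap : ∀ t r → t * (2 * r) ≡ 2 * (t * r)
    swap = solve-∀
    swap′ : ∀ t r → t * (2 * r) ≡ t * r * 2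
    swap′ = solve-∀

ℚ-bound : ∀ n a g t c → n * (a * suc t + g) ≤ c * suc t →
          ((+ n) ℚ./ 1) ℚ.* ((+ a) ℚ./ 1 ℚ.+ (+ g) ℚ./ suc t) ℚ.≤ (+ c) ℚ./ 1
ℚ-bound n a g t c n[at+g]≤ct = toℚᵘ-cancel-≤
  (ℚᵘ.≤-respˡ-≃ (ℚᵘ.≃-sym toℚᵘ-lhs) (ℚᵘ.≤-respʳ-≃ (ℚᵘ.≃-sym (toℚᵘ-fromℚᵘ (mkℚᵘ (+ c) 0))) (ℚᵘ.*≤* cross)))
  where
  toℚᵘ-lhs : ℚ.toℚᵘ (((+ n) ℚ./ 1) ℚ.* ((+ a) ℚ./ 1 ℚ.+ (+ g) ℚ./ suc t))
             ℚᵘ.≃ mkℚᵘ (+ n) 0 ℚᵘ.* (mkℚᵘ (+ a) 0 ℚᵘ.+ mkℚᵘ (+ g) t)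
  toℚᵘ-lhs = ℚᵘ.≃-trans (toℚᵘ-homo-* ((+ n) ℚ./ 1) ((+ a) ℚ./ 1 ℚ.+ (+ g) ℚ./ suc t))
    (ℚᵘ.*-cong (toℚᵘ-fromℚᵘ (mkℚᵘ (+ n) 0))
      (ℚᵘ.≃-trans (toℚᵘ-homo-+ ((+ a) ℚ./ 1) ((+ g) ℚ./ suc t))
                  (ℚᵘ.+-cong (toℚᵘ-fromℚᵘ (mkℚᵘ (+ a) 0)) (toℚᵘ-fromℚᵘ (mkℚᵘ (+ g) t)))))
  cross : (+ n ℤ.* (+ a ℤ.* + suc t ℤ.+ + g ℤ.* + 1)) ℤ.* + 1 ℤ.≤ + c ℤ.* + (1 * (1 * suc t))
  cross = subst₂ ℤ._≤_ lhs≡ (pos-* c (1 * (1 * suc t))) (+≤+ (subst₂ _≤_ (shape₁ n a g t) (shape₂ c t) n[at+g]≤ct))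
    where
    shape₁ : ∀ n a g t → n * (a * suc t + g) ≡ n * (a * suc t + g * 1) * 1
    shape₁ = solve-∀
    shape₂ : ∀ c t → c * suc t ≡ c * (1 * (1 * suc t))
    shape₂ = solve-∀
    lhs≡ : + (n * (a * suc t + g * 1) * 1) ≡ (+ n ℤ.* (+ a ℤ.* + suc t ℤ.+ + g ℤ.* + 1)) ℤ.* + 1
    lhs≡ = trans (pos-* (n * (a * suc t + g * 1)) 1) (cong (ℤ._* + 1) (trans (pos-* n (a * suc t + g * 1)) (cong (+ n ℤ.*_)
             (trans (pos-+ (a * suc t) (g * 1)) (cong₂ ℤ._+_ (pos-* a (suc t)) (pos-* g 1))))))

ℚ-bound₀ : ∀ n a c → n * a ≤ c → ((+ n) ℚ./ 1) ℚ.* ((+ a) ℚ./ 1 ℚ.+ ℚ.0ℚ) ℚ.≤ (+ c) ℚ./ 1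
ℚ-bound₀ n a c n*a≤c = ℚ-bound n a 0 0 c (subst₂ _≤_ (shape₁ n a) (sym (*-identityʳ c)) n*a≤c)
  where
  shape₁ : ∀ n a → n * a ≡ n * (a * 1 + 0)
  shape₁ = solve-∀

separated-bound : ∀ {v n} (B : Fin n → Subset v) q → Separated q B →
                  ((+ n) ℚ./ 1) ℚ.* K v q ℚ.≤ (+ (v C ⌊v/2⌋ v)) ℚ./ 1
separated-bound {v} {n} B q separated with parity q
... | inj₁ (q%2≡0 , q≡r+r) =
  subst (λ k → ((+ n) ℚ./ 1) ℚ.* k ℚ.≤ _) (sym (trans (K-even v q q%2≡0) (sym (ℚ.+-identityʳ _))))
    (ℚ-bound₀ n (Keven v (q / 2)) (v C ⌊v/2⌋ v) (Keven-bound B q (q / 2) separated (≤-reflexive (sym q≡r+r))))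
... | inj₂ (q%2≡1 , q≡1+r+r) with (2 * ⌊v/2⌋ v) / suc q in T≡
...   | zero =
  subst (λ k → ((+ n) ℚ./ 1) ℚ.* k ℚ.≤ _) (sym (trans (K-odd v q q%2≡1) (cong (((+ Keven v (q / 2)) ℚ./ 1) ℚ.+_) (oddTerm-zero v q T≡))))
    (ℚ-bound₀ n (Keven v (q / 2)) (v C ⌊v/2⌋ v)
      (Keven-bound B q (q / 2) separated (≤-trans (n≤1+n _) (≤-reflexive (sym q≡1+r+r)))))
...   | suc t =
  subst (λ k → ((+ n) ℚ./ 1) ℚ.* k ℚ.≤ _) (sym (trans (K-odd v q q%2≡1) (cong (((+ Keven v (q / 2)) ℚ./ 1) ℚ.+_) (oddTerm-suc v q t T≡))))
    (ℚ-bound n (Keven v (q / 2)) ((⌊v/2⌋ v C (suc q / 2)) * (⌈v/2⌉ v C (suc q / 2))) t (v C ⌊v/2⌋ v)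
      (Kodd-bound B q (q / 2) t separated q≡1+r+r T≡))

-- The argument does not use 1 ≤ v (for v = 0 the family has at most one member).
theorem1 : (v q n : ℕ) → 1 ≤ v → (D : Design v n) → InS v 1 q (dual D) →
    ((+ n) ℚ./ 1) ℚ.* K v q ℚ.≤ (+ (v C ⌊v/2⌋ v)) ℚ./ 1
theorem1 v q n _ D inS = separated-bound (lookup (dual D)) q (solution-separated (dual D) inS)
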